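{- Let $t\ge1$ and $n\ge1$. In the $\mathfrak{S}_n^{\times t}$-module $\tilde H_{n-2}(B_n^{(t)})$, (1) the multiplicity of the trivial representation is $0$ unless $n=1$, in which case it is $1$; (2) the multiplicity of the sign representation $\mathrm{sgn}\otimes\cdots\otimes\mathrm{sgn}$ is $1$.
   Context: $B_n$ is the Boolean lattice of subsets of $[n]$. For $t\ge2$ the $t$-fold Segre power $B_n^{(t)}$ is the subposet of $B_n\times\cdots\times B_n$ ($t$ factors, componentwise order) of $t$-tuples $(A_1,\ldots,A_t)$ with $|A_1|=\cdots=|A_t|$; $B_n^{(1)}=B_n$. $\mathfrak{S}_n^{\times t}$ acts coordinatewise: $(\sigma_1,\ldots,\sigma_t)\cdot(A_1,\ldots,A_t)=(\sigma_1(A_1),\ldots,\sigma_t(A_t))$. $\tilde H_{n-2}(B_n^{(t)})$ is the top reduced rational homology of the order complex of the proper part $B_n^{(t)}\setminus\{\hat0,\hat1\}$, with the induced action (for $n=1$ this is $\tilde H_{ -1}$ of the empty complex, the one-dimensional trivial module). -}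

module Defs where

open import Data.Bool using (Bool; true; false; _∧_; _∨_; not; if_then_else_; T)
open import Data.Nat as ℕ using (ℕ; zero; suc; _∸_; _≡ᵇ_; _<ᵇ_)
open import Data.Fin using (Fin; toℕ)
open import Data.Fin.Subset using (Subset)
open import Data.Fin.Permutation using (Permutation′; _⟨$⟩ʳ_; _⟨$⟩ˡ_)
open import Data.Vec as Vec using (Vec; []; _∷_; tabulate; lookup; zipWith)
open import Data.List as List using (List; []; _∷_; _++_; map; foldr; length; allFin; filter; concatMap; upTo)
open import Data.Rational using (ℚ; 0ℚ; 1ℚ; -_; _+_; _*_)
open import Data.Product using (Σ; _×_; _,_; ∃)
open import Relation.Binary.PropositionalEquality using (_≡_; _≢_)
open import Relation.Nullary using (¬_)

-- Elements of B_n^{(t)} : t-tuples of subsets of [n] (Subset n = Vec Bool n).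
-- The equal-cardinality condition is imposed by the Boolean predicates below.

Elem : ℕ → ℕ → Set
Elem n t = Vec (Subset n) t

card : ∀ {n} → Subset n → ℕ
card [] = 0
card (true ∷ A) = suc (card A)
card (false ∷ A) = card A

allV : ∀ {A : Set} {k} → (A → Bool) → Vec A k → Bool
allV p [] = true
allV p (x ∷ xs) = p x ∧ allV p xs

allL : ∀ {A : Set} → (A → Bool) → List A → Bool
allL p [] = true
allL p (x ∷ xs) = p x ∧ allL p xs

anyL : ∀ {A : Set} → (A → Bool) → List A → Bool
anyL p [] = false
anyL p (x ∷ xs) = p x ∨ anyL p xs

-- x is an element of the proper part of B_n^{(t)}:
-- all coordinates have a common cardinality k with 0 < k < n
properB : ∀ {n t} → Elem n t → Bool
properB {n} x = anyL (λ k → (0 <ᵇ k) ∧ (k <ᵇ n) ∧ allV (λ A → card A ≡ᵇ k) x) (upTo n)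

subsetB : ∀ {n} → Subset n → Subset n → Bool
subsetB [] [] = true
subsetB (a ∷ A) (b ∷ B) = (not a ∨ b) ∧ subsetB A B

eqBool : Bool → Bool → Bool
eqBool true b = b
eqBool false b = not b

eqSub : ∀ {n} → Subset n → Subset n → Bool
eqSub [] [] = true
eqSub (a ∷ A) (b ∷ B) = eqBool a b ∧ eqSub A B

leqB : ∀ {n t} → Elem n t → Elem n t → Bool
leqB [] [] = true
leqB (A ∷ x) (B ∷ y) = subsetB A B ∧ leqB x y

eqE : ∀ {n t} → Elem n t → Elem n t → Bool
eqE [] [] = true
eqE (A ∷ x) (B ∷ y) = eqSub A B ∧ eqE x y

ltB : ∀ {n t} → Elem n t → Elem n t → Bool
ltB x y = leqB x y ∧ not (eqE x y)

-- strictly increasing list (x₀ < x₁ < ... ) of elements of the proper part: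
-- a simplex of the order complex, listed in increasing (= orientation) order
increasing : ∀ {n t} → List (Elem n t) → Bool
increasing [] = true
increasing (x ∷ []) = true
increasing (x ∷ y ∷ c) = ltB x y ∧ increasing (y ∷ c)

chainB : ∀ {n t} → List (Elem n t) → Bool
chainB c = allL properB c ∧ increasing c

allSubsets : (n : ℕ) → List (Subset n)
allSubsets zero = [] ∷ []
allSubsets (suc n) = map (true ∷_) (allSubsets n) ++ map (false ∷_) (allSubsets n)

allElems : (n t : ℕ) → List (Elem n t)
allElems n zero = [] ∷ []
allElems n (suc t) = concatMap (λ A → map (A ∷_) (allElems n t)) (allSubsets n)

-- Rational chains of the order complex: a k-chain is a function v
-- assigning a coefficient to each oriented k-simplex (only its values on
-- lists c with T (chainB c) and length c ≡ k+1 matter).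
-- The reduced complex includes the empty simplex (length 0) in degree -1.

sumℚ : List ℚ → ℚ
sumℚ = foldr _+_ 0ℚ

insertAt : ∀ {A : Set} → ℕ → A → List A → List A
insertAt zero x c = x ∷ c
insertAt (suc i) x [] = x ∷ []
insertAt (suc i) x (y ∷ c) = y ∷ insertAt i x c

signℕ : ℕ → ℚ
signℕ zero = 1ℚ
signℕ (suc i) = - signℕ i

-- coefficient of the simplex c in the simplicial boundary ∂v
-- ∂(x₀<…<x_k) = Σᵢ (-1)^i (x₀<…x̂ᵢ…<x_k)
boundaryAt : ∀ {n t} → (List (Elem n t) → ℚ) → List (Elem n t) → ℚ
boundaryAt {n} {t} v c =
  sumℚ (concatMap (λ i → map (λ x → let d = insertAt i x c in
                                    if chainB d then signℕ i * v d else 0ℚ)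
                             (allElems n t))
                  (upTo (suc (length c))))

-- top-dimensional simplices: chains with n-1 elements (dimension n-2)
TopChain : (n t : ℕ) → List (Elem n t) → Set
TopChain n t c = T (chainB c) × length c ≡ n ∸ 1

-- v is a top-dimensional cycle, i.e. an element of H̃_{n-2} (there are no
-- (n-1)-simplices, so H̃_{n-2} = Z_{n-2})
IsTopCycle : (n t : ℕ) → (List (Elem n t) → ℚ) → Set
IsTopCycle n t v = ∀ (c : List (Elem n t)) → T (chainB c) → suc (length c) ≡ n ∸ 1 → boundaryAt v c ≡ 0ℚ

Group : ℕ → ℕ → Set
Group n t = Vec (Permutation′ n) t

-- σ(A) = { σ i | i ∈ A }
permSub : ∀ {n} → Permutation′ n → Subset n → Subset n
permSub σ A = tabulate (λ j → lookup A (σ ⟨$⟩ˡ j))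

actE : ∀ {n t} → Group n t → Elem n t → Elem n t
actE g x = zipWith permSub g x

actChain : ∀ {n t} → Group n t → List (Elem n t) → List (Elem n t)
actChain g c = map (actE g) c

inversions : ∀ {n} → Permutation′ n → ℕ
inversions {n} σ =
  length (filter (λ p → Data.Nat._<?_ (toℕ (σ ⟨$⟩ʳ Data.Product.proj₂ p)) (toℕ (σ ⟨$⟩ʳ Data.Product.proj₁ p)))
    (concatMap (λ i → map (λ j → (i , j)) (List.filter (λ j → Data.Nat._<?_ (toℕ i) (toℕ j)) (allFin n))) (allFin n)))
  where import Data.Nat

sgn : ∀ {n} → Permutation′ n → ℚ
sgn σ = signℕ (inversions σ)

trivialχ : ∀ {n t} → Group n t → ℚ
trivialχ g = 1ℚ

signχ : ∀ {n t} → Group n t → ℚ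
signχ [] = 1ℚ
signχ (σ ∷ g) = sgn σ * signχ g

-- χ-isotypic top cycles: v ∈ H̃_{n-2} with g·v = χ(g) v for all g.
-- (g·v)(g·c) = v(c); so g·v = χ(g)v  ⟺  v(g·c) = χ(g) v(c).

IsχCycle : (n t : ℕ) → (Group n t → ℚ) → (List (Elem n t) → ℚ) → Set
IsχCycle n t χ v =
  IsTopCycle n t v ×
  (∀ (g : Group n t) (c : List (Elem n t)) → TopChain n t c → v (actChain g c) ≡ χ g * v c)

NonZeroChain : (n t : ℕ) → (List (Elem n t) → ℚ) → Set
NonZeroChain n t v = ∃ λ c → TopChain n t c × v c ≢ 0ℚ

-- The multiplicity of the one-dimensional representation χ in H̃_{n-2}
-- (= dimension of the χ-isotypic subspace) is 0
Multiplicity0 : (n t : ℕ) → (Group n t → ℚ) → Set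
Multiplicity0 n t χ = ∀ v → IsχCycle n t χ v → ¬ NonZeroChain n t v

Multiplicity1 : (n t : ℕ) → (Group n t → ℚ) → Set
Multiplicity1 n t χ =
  (∃ λ v → IsχCycle n t χ v × NonZeroChain n t v) ×
  (∀ v w → IsχCycle n t χ v → NonZeroChain n t v → IsχCycle n t χ w →
     ∃ λ (λ′ : ℚ) → ∀ c → TopChain n t c → w c ≡ λ′ * v c)

{-# OPTIONS --safe #-}
module Submission where

-- A top simplex of B_n^(t) is a t-tuple of maximal chains of B_n, i.e. of permutations: in the j-th
-- coordinate the point a enters at step rank c j a. So 𝔖_n^{×t} acts transitively on top simplices,
-- and a χ-isotypic top cycle is determined by its value at one of them; every multiplicity is at
-- most 1. The product of the signs of the t coordinate permutations is a cycle: in its boundary at a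
-- chain missing level i, the two ways of completing the first coordinate at that level differ by an
-- adjacent transposition and cancel. An invariant cycle is constant, say α, on top simplices; at the
-- standard chain with its bottom removed, its boundary is a sum of terms 0 or α, one of them α, so
-- α = 0 as soon as n ≥ 2.

open import Algebra.Bundles using (CommutativeRing)
import Algebra.Properties.CommutativeSemigroup as CommutativeSemigroupProperties
open import Data.Bool using (Bool; true; false; not; _∧_; _xor_; T; if_then_else_)
open import Data.Bool.Properties
  using (xor-assoc; xor-comm; xor-same; xor-identityʳ; not-involutive; not-distribˡ-xor; T-≡; T-not-≡; T-∧; T-∨;
         xor-annihilates-not; ∧-distribˡ-xor; ∧-zeroʳ; xor-∧-commutativeRing)
open import Data.Empty using (⊥; ⊥-elim)
open import Data.Unit using (⊤)
open import Data.Fin using (Fin; toℕ; fromℕ<) renaming (zero to fzero; suc to fsuc)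
import Data.Fin.Properties as Fin
open import Data.Fin.Permutation using (Permutation′; _⟨$⟩ʳ_; _⟨$⟩ˡ_; inverseˡ; inverseʳ; flip; permutation)
open import Data.List using (List; []; _∷_; _++_; map; allFin; filter; concatMap; length; upTo; applyUpTo)
import Data.List.Properties as List
open import Data.List.Membership.Propositional using (_∈_; lose)
open import Data.List.Membership.Propositional.Properties
  using (∈-map⁺; ∈-allFin; ∈-upTo⁺; ∈-upTo⁻; ∈-applyUpTo⁻; ∈-++⁺ˡ; ∈-++⁺ʳ; ∈-concatMap⁺)
open import Data.List.Membership.Propositional.Properties.WithK using (unique∧set⇒bag)
open import Data.List.Relation.Binary.BagAndSetEquality using (∼bag⇒↭)
open import Data.List.Relation.Binary.Permutation.Propositional using (_↭_; refl; prep; swap; trans)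
open import Data.List.Relation.Unary.All using (All; []; _∷_)
import Data.List.Relation.Unary.All as All
open import Data.List.Relation.Unary.Any using (here; there)
open import Data.List.Relation.Unary.Linked using (Linked; []; [-]; _∷_)
import Data.List.Relation.Unary.Linked as Linked
open import Data.List.Relation.Unary.Unique.Propositional.Properties using (allFin⁺; map⁺)
open import Data.Nat using (ℕ; zero; suc; _+_; _≤_; _<_; _<ᵇ_; _≤ᵇ_; _≡ᵇ_; _<?_; z≤n; s≤s)
import Data.Nat.Properties as ℕ
open import Data.Rational using (ℚ; 0ℚ; 1ℚ; -_)
import Data.Rational as ℚ
import Data.Rational.Properties as ℚ
open import Data.Vec using (Vec; []; _∷_; lookup; tabulate; zipWith)
import Data.Vec.Properties as Vec
open import Data.Vec.Relation.Binary.Pointwise.Extensional using (ext; Pointwise-≡⇒≡)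
open import Data.Product using (Σ; _×_; _,_; ∃; proj₁; proj₂)
open import Data.Sum using (_⊎_; inj₁; inj₂)
open import Data.Fin.Subset using (Subset)
open import Function.Bundles using (Equivalence; mk⇔)
open import Relation.Binary.Definitions using (tri<; tri≈; tri>)
open import Relation.Nullary using (Dec; does; yes; no)
open import Relation.Binary.PropositionalEquality
  using (_≡_; _≢_; refl; sym; cong; cong₂; subst; subst₂; module ≡-Reasoning)
  renaming (trans to ≡-trans)

open import Defs

open CommutativeSemigroupProperties (CommutativeRing.+-commutativeSemigroup xor-∧-commutativeRing)
  using (interchange; x∙yz≈y∙xz)
open CommutativeSemigroupProperties ℕ.+-commutativeSemigroup
  using () renaming (interchange to +-interchange; x∙yz≈y∙xz to x∙yz≈y∙xzℕ)
open CommutativeSemigroupProperties (CommutativeRing.*-commutativeSemigroup ℚ.+-*-commutativeRing)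
  using () renaming (x∙yz≈y∙xz to x∙yz≈y∙xzℚ)

xorSum : {A : Set} → (A → Bool) → List A → Bool
xorSum f []       = false
xorSum f (x ∷ xs) = f x xor xorSum f xs

xorSum-cong : {A : Set} {f g : A → Bool} → (∀ x → f x ≡ g x) → ∀ xs → xorSum f xs ≡ xorSum g xs
xorSum-cong f≡g []       = refl
xorSum-cong f≡g (x ∷ xs) = cong₂ _xor_ (f≡g x) (xorSum-cong f≡g xs)

xorSum-xor : {A : Set} (f g : A → Bool) (xs : List A) → xorSum (λ x → f x xor g x) xs ≡ xorSum f xs xor xorSum g xs
xorSum-xor f g []       = refl
xorSum-xor f g (x ∷ xs) = ≡-trans (cong ((f x xor g x) xor_) (xorSum-xor f g xs)) (interchange (f x) (g x) _ _)

xorSum-∧ : {A : Set} (b : Bool) (f : A → Bool) (xs : List A) → xorSum (λ x → b ∧ f x) xs ≡ b ∧ xorSum f xs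
xorSum-∧ b f []       = sym (∧-zeroʳ b)
xorSum-∧ b f (x ∷ xs) = ≡-trans (cong ((b ∧ f x) xor_) (xorSum-∧ b f xs)) (sym (∧-distribˡ-xor b (f x) _))

xorSum-map : {A B : Set} (f : B → Bool) (g : A → B) (xs : List A) → xorSum f (map g xs) ≡ xorSum (λ x → f (g x)) xs
xorSum-map f g []       = refl
xorSum-map f g (x ∷ xs) = cong (f (g x) xor_) (xorSum-map f g xs)

xorSum-++ : {A : Set} (f : A → Bool) (xs ys : List A) → xorSum f (xs ++ ys) ≡ xorSum f xs xor xorSum f ys
xorSum-++ f []       ys = refl
xorSum-++ f (x ∷ xs) ys = ≡-trans (cong (f x xor_) (xorSum-++ f xs ys)) (sym (xor-assoc (f x) _ _))

xorSum-concatMap : {A B : Set} (f : B → Bool) (g : A → List B) (xs : List A) →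
                   xorSum f (concatMap g xs) ≡ xorSum (λ x → xorSum f (g x)) xs
xorSum-concatMap f g []       = refl
xorSum-concatMap f g (x ∷ xs) =
  ≡-trans (xorSum-++ f (g x) (concatMap g xs)) (cong (xorSum f (g x) xor_) (xorSum-concatMap f g xs))

xorSum-filter : {A : Set} {P : A → Set} (P? : ∀ x → Dec (P x)) (f : A → Bool) (xs : List A) →
                xorSum f (filter P? xs) ≡ xorSum (λ x → does (P? x) ∧ f x) xs
xorSum-filter P? f []       = refl
xorSum-filter P? f (x ∷ xs) with P? x
... | yes _ = cong (f x xor_) (xorSum-filter P? f xs)
... | no  _ = xorSum-filter P? f xs

xorSum-↭ : {A : Set} (f : A → Bool) {xs ys : List A} → xs ↭ ys → xorSum f xs ≡ xorSum f ys
xorSum-↭ f refl          = refl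
xorSum-↭ f (prep x p)    = cong (f x xor_) (xorSum-↭ f p)
xorSum-↭ f (swap x y p)  = ≡-trans (cong (λ s → f x xor (f y xor s)) (xorSum-↭ f p)) (x∙yz≈y∙xz (f x) (f y) _)
xorSum-↭ f (trans p q)   = ≡-trans (xorSum-↭ f p) (xorSum-↭ f q)

pairXorSum : {A : Set} → (A → A → Bool) → List A → Bool
pairXorSum u []       = false
pairXorSum u (x ∷ xs) = xorSum (u x) xs xor pairXorSum u xs

pairXorSum-cong : {A : Set} {u w : A → A → Bool} → (∀ x y → u x y ≡ w x y) → ∀ xs →
                  pairXorSum u xs ≡ pairXorSum w xs
pairXorSum-cong u≡w []       = refl
pairXorSum-cong u≡w (x ∷ xs) = cong₂ _xor_ (xorSum-cong (u≡w x) xs) (pairXorSum-cong u≡w xs)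

pairXorSum-xor : {A : Set} (u w : A → A → Bool) (xs : List A) →
                 pairXorSum (λ x y → u x y xor w x y) xs ≡ pairXorSum u xs xor pairXorSum w xs
pairXorSum-xor u w []       = refl
pairXorSum-xor u w (x ∷ xs) =
  ≡-trans (cong₂ _xor_ (xorSum-xor (u x) (w x) xs) (pairXorSum-xor u w xs))
          (interchange (xorSum (u x) xs) (xorSum (w x) xs) (pairXorSum u xs) (pairXorSum w xs))

pairXorSum-map : {A B : Set} (u : B → B → Bool) (g : A → B) (xs : List A) →
                 pairXorSum u (map g xs) ≡ pairXorSum (λ x y → u (g x) (g y)) xs
pairXorSum-map u g []       = refl
pairXorSum-map u g (x ∷ xs) = cong₂ _xor_ (xorSum-map (u (g x)) g xs) (pairXorSum-map u g xs)

pairXorSum-↭ : {A : Set} (u : A → A → Bool) → (∀ x y → u x y ≡ u y x) →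
               {xs ys : List A} → xs ↭ ys → pairXorSum u xs ≡ pairXorSum u ys
pairXorSum-↭ u u-sym refl         = refl
pairXorSum-↭ u u-sym (prep x p)   = cong₂ _xor_ (xorSum-↭ (u x) p) (pairXorSum-↭ u u-sym p)
pairXorSum-↭ u u-sym (swap {xs} {ys} x y p) = begin
  (u x y xor xorSum (u x) xs) xor (xorSum (u y) xs xor pairXorSum u xs)
    ≡⟨ cong₂ (λ s r → (u x y xor s) xor r) (xorSum-↭ (u x) p)
             (cong₂ _xor_ (xorSum-↭ (u y) p) (pairXorSum-↭ u u-sym p)) ⟩
  (u x y xor xorSum (u x) ys) xor (xorSum (u y) ys xor pairXorSum u ys)
    ≡⟨ interchange (u x y) (xorSum (u x) ys) (xorSum (u y) ys) (pairXorSum u ys) ⟩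
  (u x y xor xorSum (u y) ys) xor (xorSum (u x) ys xor pairXorSum u ys)
    ≡⟨ cong (λ b → (b xor xorSum (u y) ys) xor (xorSum (u x) ys xor pairXorSum u ys)) (u-sym x y) ⟩
  (u y x xor xorSum (u y) ys) xor (xorSum (u x) ys xor pairXorSum u ys) ∎
  where open ≡-Reasoning
pairXorSum-↭ u u-sym (trans p q)  = ≡-trans (pairXorSum-↭ u u-sym p) (pairXorSum-↭ u u-sym q)

-- The pairs counted are those joining P to Q, and there are |P| · |Q| of them.
pairXorSum-disjoint : {A : Set} (P Q : A → Bool) → (∀ x → P x ∧ Q x ≡ false) → ∀ xs →
  pairXorSum (λ x y → (P x ∧ Q y) xor (Q x ∧ P y)) xs ≡ xorSum P xs ∧ xorSum Q xs
pairXorSum-disjoint P Q disjoint []       = refl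
pairXorSum-disjoint P Q disjoint (x ∷ xs) =
  ≡-trans (cong₂ _xor_ (≡-trans (xorSum-xor (λ y → P x ∧ Q y) (λ y → Q x ∧ P y) xs)
                                (cong₂ _xor_ (xorSum-∧ (P x) Q xs) (xorSum-∧ (Q x) P xs)))
                       (pairXorSum-disjoint P Q disjoint xs))
          (step (P x) (Q x) (xorSum P xs) (xorSum Q xs) (disjoint x))
  where
  step : ∀ p q p′ q′ → p ∧ q ≡ false →
         ((p ∧ q′) xor (q ∧ p′)) xor (p′ ∧ q′) ≡ (p xor p′) ∧ (q xor q′)
  step true  true  p′ q′ ()
  step true  false true  true  _ = refl
  step true  false true  false _ = refl
  step true  false false true  _ = refl
  step true  false false false _ = refl
  step false true  true  true  _ = refl
  step false true  true  false _ = refl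
  step false false true  q′    _ = refl
  step false true  false q′    _ = refl
  step false false false q′    _ = refl

xor-moveʳ : ∀ a b c → a xor b ≡ c → a ≡ c xor b
xor-moveʳ a b c refl = begin
  a                  ≡⟨ sym (xor-identityʳ a) ⟩
  a xor false        ≡⟨ cong (a xor_) (sym (xor-same b)) ⟩
  a xor (b xor b)    ≡⟨ sym (xor-assoc a b b) ⟩
  (a xor b) xor b    ∎
  where open ≡-Reasoning

indicator : Bool → ℕ
indicator true  = 1
indicator false = 0

odd : ℕ → Bool
odd zero    = false
odd (suc m) = not (odd m)

odd-+ : ∀ m n → odd (m + n) ≡ odd m xor odd n
odd-+ zero    n = refl
odd-+ (suc m) n = ≡-trans (cong not (odd-+ m n)) (not-distribˡ-xor (odd m) (odd n))

odd-indicator : ∀ b → odd (indicator b) ≡ b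
odd-indicator true  = refl
odd-indicator false = refl

count : ∀ {n} → (Fin n → Bool) → ℕ
count {zero}  p = 0
count {suc n} p = indicator (p fzero) + count (λ a → p (fsuc a))

count-cong : ∀ {n} {p q : Fin n → Bool} → (∀ a → p a ≡ q a) → count p ≡ count q
count-cong {zero}  p≡q = refl
count-cong {suc n} p≡q = cong₂ _+_ (cong indicator (p≡q fzero)) (count-cong (λ a → p≡q (fsuc a)))

count-+ : ∀ {n} (p q r : Fin n → Bool) → (∀ a → indicator (p a) ≡ indicator (q a) + indicator (r a)) →
          count p ≡ count q + count r
count-+ {zero}  p q r split = refl
count-+ {suc n} p q r split = ≡-trans
  (cong₂ _+_ (split fzero) (count-+ (λ a → p (fsuc a)) (λ a → q (fsuc a)) (λ a → r (fsuc a)) (λ a → split (fsuc a))))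
  (+-interchange (indicator (q fzero)) (indicator (r fzero)) _ _)

count-all : ∀ {n} (p : Fin n → Bool) → (∀ a → p a ≡ true) → count p ≡ n
count-all {zero}  p all = refl
count-all {suc n} p all = cong₂ _+_ (cong indicator (all fzero)) (count-all (λ a → p (fsuc a)) (λ a → all (fsuc a)))

count-none : ∀ {n} (p : Fin n → Bool) → (∀ a → p a ≡ false) → count p ≡ 0
count-none {zero}  p none = refl
count-none {suc n} p none = cong₂ _+_ (cong indicator (none fzero)) (count-none (λ a → p (fsuc a)) (λ a → none (fsuc a)))

count≡0⇒false : ∀ {n} (p : Fin n → Bool) → count p ≡ 0 → ∀ a → p a ≡ false
count≡0⇒false {suc n} p c≡0 fzero    = indicator≡0 (p fzero) (ℕ.m+n≡0⇒m≡0 (indicator (p fzero)) c≡0)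
  where
  indicator≡0 : ∀ b → indicator b ≡ 0 → b ≡ false
  indicator≡0 false _ = refl
count≡0⇒false {suc n} p c≡0 (fsuc a) = count≡0⇒false (λ a → p (fsuc a)) (ℕ.m+n≡0⇒n≡0 (indicator (p fzero)) c≡0) a

count-witness : ∀ {n} (p : Fin n → Bool) {k} → count p ≡ suc k → ∃ λ a → p a ≡ true
count-witness {suc n} p c≡1+k with p fzero in p0
... | true  = fzero , p0
... | false = let a , pa = count-witness (λ a → p (fsuc a)) c≡1+k in fsuc a , pa

count-unique : ∀ {n} (p : Fin n → Bool) → count p ≡ 1 → ∀ {a b} → p a ≡ true → p b ≡ true → a ≡ b
count-unique {suc n} p c≡1 {a} {b} pa pb with p fzero in p0
... | true  = ≡-trans (isHead a pa) (sym (isHead b pb))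
  where
  isHead : ∀ x → p x ≡ true → x ≡ fzero
  isHead fzero    _  = refl
  isHead (fsuc x) px with () ← ≡-trans (sym px) (count≡0⇒false (λ a → p (fsuc a)) (ℕ.suc-injective c≡1) x)
... | false = inTail a b pa pb
  where
  inTail : ∀ x y → p x ≡ true → p y ≡ true → x ≡ y
  inTail fzero    _        px _  with () ← ≡-trans (sym px) p0
  inTail (fsuc x) fzero    _  py with () ← ≡-trans (sym py) p0
  inTail (fsuc x) (fsuc y) px py = cong fsuc (count-unique (λ a → p (fsuc a)) c≡1 px py)

allFin-suc : ∀ n → allFin (suc n) ≡ fzero ∷ map fsuc (allFin n)
allFin-suc n = cong (fzero ∷_) (sym (List.map-tabulate (λ a → a) fsuc))

xorSum-allFin-suc : ∀ {n} (p : Fin (suc n) → Bool) →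
                    xorSum p (allFin (suc n)) ≡ p fzero xor xorSum (λ a → p (fsuc a)) (allFin n)
xorSum-allFin-suc {n} p = ≡-trans (cong (xorSum p) (allFin-suc n)) (cong (p fzero xor_) (xorSum-map p fsuc (allFin n)))

xorSum-allFin : ∀ {n} (p : Fin n → Bool) → xorSum p (allFin n) ≡ odd (count p)
xorSum-allFin {zero}  p = refl
xorSum-allFin {suc n} p = begin
  xorSum p (allFin (suc n))
    ≡⟨ xorSum-allFin-suc p ⟩
  p fzero xor xorSum (λ a → p (fsuc a)) (allFin n)
    ≡⟨ cong₂ _xor_ (sym (odd-indicator (p fzero))) (xorSum-allFin (λ a → p (fsuc a))) ⟩
  odd (indicator (p fzero)) xor odd (count (λ a → p (fsuc a)))
    ≡⟨ sym (odd-+ (indicator (p fzero)) _) ⟩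
  odd (count p) ∎
  where open ≡-Reasoning

pairXorSum-allFin-suc : ∀ {n} (u : Fin (suc n) → Fin (suc n) → Bool) →
  pairXorSum u (allFin (suc n)) ≡
  xorSum (λ a → u fzero (fsuc a)) (allFin n) xor pairXorSum (λ a b → u (fsuc a) (fsuc b)) (allFin n)
pairXorSum-allFin-suc {n} u = ≡-trans (cong (pairXorSum u) (allFin-suc n))
  (cong₂ _xor_ (xorSum-map (u fzero) fsuc (allFin n)) (pairXorSum-map u fsuc (allFin n)))

inversionParity : ∀ {n} → (Fin n → ℕ) → Bool
inversionParity {n} f = pairXorSum (λ a b → f b <ᵇ f a) (allFin n)

parity : ∀ {n} → Permutation′ n → Bool
parity σ = inversionParity (λ a → toℕ (σ ⟨$⟩ʳ a))

inversionParity-toℕ : ∀ n → inversionParity {n} toℕ ≡ false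
inversionParity-toℕ zero    = refl
inversionParity-toℕ (suc n) = ≡-trans (pairXorSum-allFin-suc {n} (λ a b → toℕ b <ᵇ toℕ a))
  (cong₂ _xor_ (xorSum-false (allFin n)) (inversionParity-toℕ n))
  where
  xorSum-false : (xs : List (Fin n)) → xorSum (λ _ → false) xs ≡ false
  xorSum-false []       = refl
  xorSum-false (x ∷ xs) = xorSum-false xs

xorSum-allFin-pairs : ∀ {n} (f : Fin n → ℕ) →
  xorSum (λ i → xorSum (λ j → (toℕ i <ᵇ toℕ j) ∧ (f j <ᵇ f i)) (allFin n)) (allFin n) ≡ inversionParity f
xorSum-allFin-pairs {zero}  f = refl
xorSum-allFin-pairs {suc n} f = begin
  xorSum (λ i → xorSum (λ j → (toℕ i <ᵇ toℕ j) ∧ (f j <ᵇ f i)) (allFin (suc n))) (allFin (suc n))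
    ≡⟨ xorSum-allFin-suc (λ i → xorSum (λ j → (toℕ i <ᵇ toℕ j) ∧ (f j <ᵇ f i)) (allFin (suc n))) ⟩
  xorSum (λ j → (0 <ᵇ toℕ j) ∧ (f j <ᵇ f fzero)) (allFin (suc n)) xor
  xorSum (λ i → xorSum (λ j → (suc (toℕ i) <ᵇ toℕ j) ∧ (f j <ᵇ f (fsuc i))) (allFin (suc n))) (allFin n)
    ≡⟨ cong₂ _xor_ (xorSum-allFin-suc (λ j → (0 <ᵇ toℕ j) ∧ (f j <ᵇ f fzero)))
                   (≡-trans (xorSum-cong (λ i → xorSum-allFin-suc (λ j → (suc (toℕ i) <ᵇ toℕ j) ∧ (f j <ᵇ f (fsuc i))))
                                         (allFin n))
                            (xorSum-allFin-pairs (λ a → f (fsuc a)))) ⟩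
  xorSum (λ a → f (fsuc a) <ᵇ f fzero) (allFin n) xor inversionParity (λ a → f (fsuc a))
    ≡⟨ sym (pairXorSum-allFin-suc (λ a b → f b <ᵇ f a)) ⟩
  inversionParity f ∎
  where open ≡-Reasoning

odd-length-filter : {A : Set} {P : A → Set} (P? : ∀ x → Dec (P x)) (xs : List A) →
                    odd (length (filter P? xs)) ≡ xorSum (λ x → does (P? x)) xs
odd-length-filter P? []       = refl
odd-length-filter P? (x ∷ xs) with P? x
... | yes _ = cong not (odd-length-filter P? xs)
... | no  _ = odd-length-filter P? xs

odd-inversions : ∀ {n} (σ : Permutation′ n) → odd (inversions σ) ≡ parity σ
odd-inversions {n} σ = begin
  odd (inversions σ)
    ≡⟨ odd-length-filter _ (concatMap (λ i → map (i ,_) (later i)) (allFin n)) ⟩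
  xorSum inverted (concatMap (λ i → map (i ,_) (later i)) (allFin n))
    ≡⟨ xorSum-concatMap inverted (λ i → map (i ,_) (later i)) (allFin n) ⟩
  xorSum (λ i → xorSum inverted (map (i ,_) (later i))) (allFin n)
    ≡⟨ xorSum-cong (λ i → ≡-trans (xorSum-map inverted (i ,_) (later i))
                                  (xorSum-filter _ (λ j → inverted (i , j)) (allFin n))) (allFin n) ⟩
  xorSum (λ i → xorSum (λ j → (toℕ i <ᵇ toℕ j) ∧ inverted (i , j)) (allFin n)) (allFin n)
    ≡⟨ xorSum-allFin-pairs (λ a → toℕ (σ ⟨$⟩ʳ a)) ⟩
  parity σ ∎
  where
  open ≡-Reasoning
  later : Fin n → List (Fin n)
  later i = filter (λ j → toℕ i <? toℕ j) (allFin n)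
  inverted : Fin n × Fin n → Bool
  inverted p = toℕ (σ ⟨$⟩ʳ proj₂ p) <ᵇ toℕ (σ ⟨$⟩ʳ proj₁ p)

permutation-injective : ∀ {n} (σ : Permutation′ n) {a b} → σ ⟨$⟩ʳ a ≡ σ ⟨$⟩ʳ b → a ≡ b
permutation-injective σ {a} {b} σa≡σb = ≡-trans (sym (inverseˡ σ)) (≡-trans (cong (σ ⟨$⟩ˡ_) σa≡σb) (inverseˡ σ))

map-allFin-↭ : ∀ {n} (σ : Permutation′ n) → map (σ ⟨$⟩ʳ_) (allFin n) ↭ allFin n
map-allFin-↭ {n} σ = ∼bag⇒↭ (unique∧set⇒bag (map⁺ (permutation-injective σ) (allFin⁺ n)) (allFin⁺ n)
  (λ {a} → mk⇔ (λ _ → ∈-allFin a)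
                (λ _ → subst (_∈ map (σ ⟨$⟩ʳ_) (allFin n)) (inverseʳ σ) (∈-map⁺ (σ ⟨$⟩ʳ_) (∈-allFin (σ ⟨$⟩ˡ a))))))

<ᵇ-flip : ∀ m n → m ≢ n → (n <ᵇ m) ≡ not (m <ᵇ n)
<ᵇ-flip zero    zero    m≢n = ⊥-elim (m≢n refl)
<ᵇ-flip zero    (suc n) m≢n = refl
<ᵇ-flip (suc m) zero    m≢n = refl
<ᵇ-flip (suc m) (suc n) m≢n = <ᵇ-flip m n (λ m≡n → m≢n (cong suc m≡n))

-- The pairs on which the orders induced by f and by toℕ disagree do not depend on the order in
-- which the pairs are listed, so relabelling by σ only adds the inversions of σ.
inversionParity-∘ʳ : ∀ {n} (f : Fin n → ℕ) → (∀ {a b} → f a ≡ f b → a ≡ b) → (σ : Permutation′ n) →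
  inversionParity (λ a → f (σ ⟨$⟩ʳ a)) ≡ inversionParity f xor parity σ
inversionParity-∘ʳ {n} f f-injective σ = xor-moveʳ _ (parity σ) _ (begin
  inversionParity (λ a → f (σ ⟨$⟩ʳ a)) xor parity σ
    ≡⟨ sym (pairXorSum-xor (λ a b → f (σ ⟨$⟩ʳ b) <ᵇ f (σ ⟨$⟩ʳ a)) (λ a b → toℕ (σ ⟨$⟩ʳ b) <ᵇ toℕ (σ ⟨$⟩ʳ a)) (allFin n)) ⟩
  pairXorSum (λ a b → disagree (σ ⟨$⟩ʳ a) (σ ⟨$⟩ʳ b)) (allFin n)
    ≡⟨ sym (pairXorSum-map disagree (σ ⟨$⟩ʳ_) (allFin n)) ⟩
  pairXorSum disagree (map (σ ⟨$⟩ʳ_) (allFin n))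
    ≡⟨ pairXorSum-↭ disagree disagree-sym (map-allFin-↭ σ) ⟩
  pairXorSum disagree (allFin n)
    ≡⟨ pairXorSum-xor (λ a b → f b <ᵇ f a) (λ a b → toℕ b <ᵇ toℕ a) (allFin n) ⟩
  inversionParity f xor inversionParity {n} toℕ
    ≡⟨ cong (inversionParity f xor_) (inversionParity-toℕ n) ⟩
  inversionParity f xor false
    ≡⟨ xor-identityʳ _ ⟩
  inversionParity f ∎)
  where
  open ≡-Reasoning
  disagree : Fin n → Fin n → Bool
  disagree a b = (f b <ᵇ f a) xor (toℕ b <ᵇ toℕ a)
  disagree-sym : ∀ a b → disagree a b ≡ disagree b a
  disagree-sym a b with a Fin.≟ b
  ... | yes refl = refl
  ... | no  a≢b  = ≡-trans (cong₂ _xor_ (<ᵇ-flip (f a) (f b) (λ e → a≢b (f-injective e)))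
                                        (<ᵇ-flip (toℕ a) (toℕ b) (λ e → a≢b (Fin.toℕ-injective e))))
                           (xor-annihilates-not (f a <ᵇ f b) (toℕ a <ᵇ toℕ b))

parity-flip : ∀ {n} (σ : Permutation′ n) → parity (flip σ) ≡ parity σ
parity-flip {n} σ = xor-moveʳ (parity (flip σ)) (parity σ) false (begin
  parity (flip σ) xor parity σ
    ≡⟨ xor-comm (parity (flip σ)) (parity σ) ⟩
  parity σ xor parity (flip σ)
    ≡⟨ sym (inversionParity-∘ʳ (λ a → toℕ (σ ⟨$⟩ʳ a)) (λ e → permutation-injective σ (Fin.toℕ-injective e)) (flip σ)) ⟩
  inversionParity (λ a → toℕ (σ ⟨$⟩ʳ (σ ⟨$⟩ˡ a)))
    ≡⟨ pairXorSum-cong (λ a b → cong₂ _<ᵇ_ (cong toℕ (inverseʳ σ)) (cong toℕ (inverseʳ σ))) (allFin n) ⟩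
  inversionParity {n} toℕ
    ≡⟨ inversionParity-toℕ n ⟩
  false ∎)
  where open ≡-Reasoning

inversionParity-∘ˡ : ∀ {n} (f : Fin n → ℕ) → (∀ {a b} → f a ≡ f b → a ≡ b) → (σ : Permutation′ n) →
  inversionParity (λ a → f (σ ⟨$⟩ˡ a)) ≡ inversionParity f xor parity σ
inversionParity-∘ˡ f f-injective σ =
  ≡-trans (inversionParity-∘ʳ f f-injective (flip σ)) (cong (inversionParity f xor_) (parity-flip σ))

sign : Bool → ℚ
sign true  = - 1ℚ
sign false = 1ℚ

sign-xor : ∀ a b → sign (a xor b) ≡ sign a ℚ.* sign b
sign-xor true  true  = refl
sign-xor true  false = refl
sign-xor false true  = refl
sign-xor false false = refl

sign-not : ∀ a → sign (not a) ≡ - sign a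
sign-not true  = refl
sign-not false = refl

sign≢0 : ∀ b → sign b ≢ 0ℚ
sign≢0 true  ()
sign≢0 false ()

signℕ≡sign∘odd : ∀ m → signℕ m ≡ sign (odd m)
signℕ≡sign∘odd zero    = refl
signℕ≡sign∘odd (suc m) = ≡-trans (cong -_ (signℕ≡sign∘odd m)) (sym (sign-not (odd m)))

sgn≡sign∘parity : ∀ {n} (σ : Permutation′ n) → sgn σ ≡ sign (parity σ)
sgn≡sign∘parity σ = ≡-trans (signℕ≡sign∘odd (inversions σ)) (cong sign (odd-inversions σ))

signχ≡sign∘parity : ∀ {n t} (g : Group n t) → signχ g ≡ sign (xorSum (λ j → parity (lookup g j)) (allFin t))
signχ≡sign∘parity []      = refl
signχ≡sign∘parity (σ ∷ g) = begin
  sgn σ ℚ.* signχ g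
    ≡⟨ cong₂ ℚ._*_ (sgn≡sign∘parity σ) (signχ≡sign∘parity g) ⟩
  sign (parity σ) ℚ.* sign (xorSum (λ j → parity (lookup g j)) (allFin _))
    ≡⟨ sym (sign-xor (parity σ) _) ⟩
  sign (parity σ xor xorSum (λ j → parity (lookup g j)) (allFin _))
    ≡⟨ cong sign (sym (xorSum-allFin-suc (λ j → parity (lookup (σ ∷ g) j)))) ⟩
  sign (xorSum (λ j → parity (lookup (σ ∷ g) j)) (allFin _)) ∎
  where open ≡-Reasoning

-- Chains as rank functions

lookup-ext : ∀ {A : Set} {m} {u v : Vec A m} → (∀ i → lookup u i ≡ lookup v i) → u ≡ v
lookup-ext u≡v = Pointwise-≡⇒≡ (ext u≡v)

_∈ᴱ_ : ∀ {n t} → Fin t × Fin n → Elem n t → Set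
(j , a) ∈ᴱ x = lookup (lookup x j) a ≡ true

_⊆ᴱ_ : ∀ {n t} → Elem n t → Elem n t → Set
x ⊆ᴱ y = ∀ j a → (j , a) ∈ᴱ x → (j , a) ∈ᴱ y

-- rank c j a is the number of members of c whose j-th coordinate misses a. On a top chain, a enters
-- the j-th coordinate at step rank c j a, and rank c j is the permutation of that coordinate.
rank : ∀ {n t} → List (Elem n t) → Fin t → Fin n → ℕ
rank []      j a = 0
rank (x ∷ c) j a = indicator (not (lookup (lookup x j) a)) + rank c j a

sublevel : ∀ {n t} → (Fin t → Fin n → ℕ) → ℕ → Elem n t
sublevel ρ k = tabulate (λ j → tabulate (λ a → ρ j a ≤ᵇ k))

sublevels : ∀ {n t} → (Fin t → Fin n → ℕ) → ℕ → ℕ → List (Elem n t)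
sublevels ρ k zero    = []
sublevels ρ k (suc m) = sublevel ρ k ∷ sublevels ρ (suc k) m

lookup-sublevel : ∀ {n t} (ρ : Fin t → Fin n → ℕ) k j a → lookup (lookup (sublevel ρ k) j) a ≡ (ρ j a ≤ᵇ k)
lookup-sublevel ρ k j a = ≡-trans (cong (λ A → lookup A a) (Vec.lookup∘tabulate _ j)) (Vec.lookup∘tabulate _ a)

sublevel-cong : ∀ {n t} (ρ ρ′ : Fin t → Fin n → ℕ) {k} → (∀ j a → (ρ j a ≤ᵇ k) ≡ (ρ′ j a ≤ᵇ k)) →
                sublevel ρ k ≡ sublevel ρ′ k
sublevel-cong ρ ρ′ ρ≡ρ′ = Vec.tabulate-cong (λ j → Vec.tabulate-cong (ρ≡ρ′ j))

sublevels-cong : ∀ {n t} {ρ ρ′ : Fin t → Fin n → ℕ} k m → (∀ l → k ≤ l → sublevel ρ l ≡ sublevel ρ′ l) →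
                 sublevels ρ k m ≡ sublevels ρ′ k m
sublevels-cong k zero    ρ≡ρ′ = refl
sublevels-cong k (suc m) ρ≡ρ′ =
  cong₂ _∷_ (ρ≡ρ′ k ℕ.≤-refl) (sublevels-cong (suc k) m (λ l k<l → ρ≡ρ′ l (ℕ.<⇒≤ k<l)))

length-sublevels : ∀ {n t} (ρ : Fin t → Fin n → ℕ) k m → length (sublevels ρ k m) ≡ m
length-sublevels ρ k zero    = refl
length-sublevels ρ k (suc m) = cong suc (length-sublevels ρ (suc k) m)

rank≡0 : ∀ {n t} {x : Elem n t} {c} → Linked _⊆ᴱ_ (x ∷ c) → ∀ j a → (j , a) ∈ᴱ x → rank c j a ≡ 0
rank≡0 [-]           j a a∈x = refl
rank≡0 (x⊆y ∷ nested) j a a∈x rewrite x⊆y j a a∈x = rank≡0 nested j a (x⊆y j a a∈x)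

≤ᵇ≡true : ∀ {m n} → m ≤ n → (m ≤ᵇ n) ≡ true
≤ᵇ≡true m≤n = Equivalence.to T-≡ (ℕ.≤⇒≤ᵇ m≤n)

≤ᵇ≡false : ∀ {m n} → n < m → (m ≤ᵇ n) ≡ false
≤ᵇ≡false {m} {n} n<m with m ≤ᵇ n in m≤ᵇn
... | false = refl
... | true  = ⊥-elim (ℕ.<⇒≱ n<m (ℕ.≤ᵇ⇒≤ m n (Equivalence.from T-≡ m≤ᵇn)))

≤ᵇ≡false⇒> : ∀ m n → (m ≤ᵇ n) ≡ false → n < m
≤ᵇ≡false⇒> m n m≰n = ℕ.≰⇒> (λ m≤n → subst T (≡-trans (sym (≤ᵇ≡true m≤n)) m≰n) _)

nested≡sublevels : ∀ {n t} (d : List (Elem n t)) → Linked _⊆ᴱ_ d → ∀ k →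
                   d ≡ sublevels (λ j a → k + rank d j a) k (length d)
nested≡sublevels []      nested k = refl
nested≡sublevels {n} {t} (x ∷ d) nested k = cong₂ _∷_ head≡ tail≡
  where
  member : ∀ j a → (k + rank (x ∷ d) j a ≤ᵇ k) ≡ lookup (lookup x j) a
  member j a with lookup (lookup x j) a in a∈x
  ... | true  rewrite rank≡0 nested j a a∈x = ≤ᵇ≡true (ℕ.≤-reflexive (ℕ.+-identityʳ k))
  ... | false = ≤ᵇ≡false (ℕ.m<m+n k (s≤s z≤n))
  ρ : Fin t → Fin n → ℕ
  ρ j a = k + rank (x ∷ d) j a
  head≡ : x ≡ sublevel ρ k
  head≡ = lookup-ext (λ j → lookup-ext (λ a → sym (≡-trans (lookup-sublevel ρ k j a) (member j a))))
  shift : ∀ l → suc k ≤ l → ∀ j a → (suc k + rank d j a ≤ᵇ l) ≡ (k + rank (x ∷ d) j a ≤ᵇ l)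
  shift l k<l j a with lookup (lookup x j) a in a∈x
  ... | true  rewrite rank≡0 nested j a a∈x =
    ≡-trans (≤ᵇ≡true (ℕ.≤-trans (ℕ.≤-reflexive (ℕ.+-identityʳ (suc k))) k<l))
            (sym (≤ᵇ≡true (ℕ.≤-trans (ℕ.≤-reflexive (ℕ.+-identityʳ k)) (ℕ.<⇒≤ k<l))))
  ... | false = cong (_≤ᵇ l) (sym (ℕ.+-suc k (rank d j a)))
  tail≡ : d ≡ sublevels ρ (suc k) (length d)
  tail≡ = ≡-trans (nested≡sublevels d (Linked.tail nested) (suc k))
                  (sublevels-cong (suc k) (length d) (λ l k<l → sublevel-cong (λ j a → suc k + rank d j a) ρ (shift l k<l)))

lookup-actE : ∀ {n t} (g : Group n t) (x : Elem n t) j a →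
              lookup (lookup (actE g x) j) a ≡ lookup (lookup x j) (lookup g j ⟨$⟩ˡ a)
lookup-actE g x j a = ≡-trans (cong (λ A → lookup A a) (Vec.lookup-zipWith permSub j g x)) (Vec.lookup∘tabulate _ a)

rank-actChain : ∀ {n t} (g : Group n t) (c : List (Elem n t)) j a →
                rank (actChain g c) j a ≡ rank c j (lookup g j ⟨$⟩ˡ a)
rank-actChain g []      j a = refl
rank-actChain g (x ∷ c) j a =
  cong₂ _+_ (cong (λ b → indicator (not b)) (lookup-actE g x j a)) (rank-actChain g c j a)

actChain-sublevels : ∀ {n t} (g : Group n t) (ρ : Fin t → Fin n → ℕ) k m →
                     actChain g (sublevels ρ k m) ≡ sublevels (λ j a → ρ j (lookup g j ⟨$⟩ˡ a)) k m
actChain-sublevels g ρ k zero    = refl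
actChain-sublevels g ρ k (suc m) = cong₂ _∷_ (lookup-ext λ j → lookup-ext λ a → begin
    lookup (lookup (actE g (sublevel ρ k)) j) a        ≡⟨ lookup-actE g (sublevel ρ k) j a ⟩
    lookup (lookup (sublevel ρ k) j) (lookup g j ⟨$⟩ˡ a) ≡⟨ lookup-sublevel ρ k j _ ⟩
    (ρ j (lookup g j ⟨$⟩ˡ a) ≤ᵇ k)                      ≡⟨ sym (lookup-sublevel (λ j a → ρ j (lookup g j ⟨$⟩ˡ a)) k j a) ⟩
    lookup (lookup (sublevel (λ j a → ρ j (lookup g j ⟨$⟩ˡ a)) k) j) a ∎)
  (actChain-sublevels g ρ (suc k) m)
  where open ≡-Reasoning

rank-insertAt : ∀ {n t} i (x : Elem n t) c j a →
                rank (insertAt i x c) j a ≡ indicator (not (lookup (lookup x j) a)) + rank c j a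
rank-insertAt zero    x c       j a = refl
rank-insertAt (suc i) x []      j a = refl
rank-insertAt (suc i) x (y ∷ c) j a =
  ≡-trans (cong (indicator (not (lookup (lookup y j) a)) +_) (rank-insertAt i x c j a))
          (x∙yz≈y∙xzℕ (indicator (not (lookup (lookup y j) a))) (indicator (not (lookup (lookup x j) a))) (rank c j a))

length-insertAt : ∀ {A : Set} i (x : A) c → length (insertAt i x c) ≡ suc (length c)
length-insertAt zero    x c       = refl
length-insertAt (suc i) x []      = refl
length-insertAt (suc i) x (y ∷ c) = cong suc (length-insertAt i x c)

chainParity : ∀ {n t} → List (Elem n t) → Bool
chainParity {n} {t} c = xorSum (λ j → inversionParity (rank c j)) (allFin t)

signCycle : ∀ {n t} → List (Elem n t) → ℚ
signCycle c = sign (chainParity c)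

signCycle-actChain : ∀ {n t} (g : Group n t) (c : List (Elem n t)) →
  (∀ j {a b} → rank c j a ≡ rank c j b → a ≡ b) → signCycle (actChain g c) ≡ signχ g ℚ.* signCycle c
signCycle-actChain {n} {t} g c rank-injective = begin
  sign (chainParity (actChain g c))
    ≡⟨ cong sign (xorSum-cong (λ j → ≡-trans (pairXorSum-cong (λ a b → cong₂ _<ᵇ_ (rank-actChain g c j b) (rank-actChain g c j a)) (allFin n))
                                             (inversionParity-∘ˡ (rank c j) (rank-injective j) (lookup g j))) (allFin t)) ⟩
  sign (xorSum (λ j → inversionParity (rank c j) xor parity (lookup g j)) (allFin t))
    ≡⟨ cong sign (≡-trans (xorSum-xor (λ j → inversionParity (rank c j)) (λ j → parity (lookup g j)) (allFin t))
                          (xor-comm (chainParity c) _)) ⟩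
  sign (xorSum (λ j → parity (lookup g j)) (allFin t) xor chainParity c)
    ≡⟨ sign-xor (xorSum (λ j → parity (lookup g j)) (allFin t)) (chainParity c) ⟩
  sign (xorSum (λ j → parity (lookup g j)) (allFin t)) ℚ.* signCycle c
    ≡⟨ cong (ℚ._* signCycle c) (sym (signχ≡sign∘parity g)) ⟩
  signχ g ℚ.* signCycle c ∎
  where open ≡-Reasoning

allL⁻ : ∀ {A : Set} (p : A → Bool) xs → T (allL p xs) → All (λ x → T (p x)) xs
allL⁻ p []       _ = []
allL⁻ p (x ∷ xs) h = let px , pxs = Equivalence.to T-∧ h in px ∷ allL⁻ p xs pxs

allL⁺ : ∀ {A : Set} (p : A → Bool) {xs} → All (λ x → T (p x)) xs → T (allL p xs)
allL⁺ p []         = _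
allL⁺ p (px ∷ pxs) = Equivalence.from T-∧ (px , allL⁺ p pxs)

anyL⁻ : ∀ {A : Set} (p : A → Bool) xs → T (anyL p xs) → ∃ λ x → T (p x)
anyL⁻ p (x ∷ xs) h with Equivalence.to T-∨ h
... | inj₁ px  = x , px
... | inj₂ pxs = anyL⁻ p xs pxs

anyL⁺ : ∀ {A : Set} (p : A → Bool) {x xs} → x ∈ xs → T (p x) → T (anyL p xs)
anyL⁺ p (here refl) px = Equivalence.from T-∨ (inj₁ px)
anyL⁺ p (there x∈)  px = Equivalence.from T-∨ (inj₂ (anyL⁺ p x∈ px))

allV⁻ : ∀ {A : Set} {m} (p : A → Bool) (v : Vec A m) → T (allV p v) → ∀ j → T (p (lookup v j))
allV⁻ p (x ∷ v) h fzero    = proj₁ (Equivalence.to T-∧ h)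
allV⁻ p (x ∷ v) h (fsuc j) = allV⁻ p v (proj₂ (Equivalence.to T-∧ h)) j

allV⁺ : ∀ {A : Set} {m} (p : A → Bool) (v : Vec A m) → (∀ j → T (p (lookup v j))) → T (allV p v)
allV⁺ p []      h = _
allV⁺ p (x ∷ v) h = Equivalence.from T-∧ (h fzero , allV⁺ p v (λ j → h (fsuc j)))

subsetB⁻ : ∀ {n} (A B : Subset n) → T (subsetB A B) → ∀ a → lookup A a ≡ true → lookup B a ≡ true
subsetB⁻ (true  ∷ A) (true ∷ B) h fzero    _   = refl
subsetB⁻ (false ∷ A) (b    ∷ B) h fzero    ()
subsetB⁻ (a     ∷ A) (b    ∷ B) h (fsuc i) A∋i = subsetB⁻ A B (proj₂ (Equivalence.to T-∧ h)) i A∋i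

subsetB⁺ : ∀ {n} (A B : Subset n) → (∀ a → lookup A a ≡ true → lookup B a ≡ true) → T (subsetB A B)
subsetB⁺ []          []      A⊆B = _
subsetB⁺ (true  ∷ A) (b ∷ B) A⊆B rewrite A⊆B fzero refl = subsetB⁺ A B (λ a → A⊆B (fsuc a))
subsetB⁺ (false ∷ A) (b ∷ B) A⊆B = subsetB⁺ A B (λ a → A⊆B (fsuc a))

leqB⁻ : ∀ {n t} (x y : Elem n t) → T (leqB x y) → x ⊆ᴱ y
leqB⁻ (A ∷ x) (B ∷ y) h fzero    = subsetB⁻ A B (proj₁ (Equivalence.to T-∧ h))
leqB⁻ (A ∷ x) (B ∷ y) h (fsuc j) = leqB⁻ x y (proj₂ (Equivalence.to T-∧ h)) j

leqB⁺ : ∀ {n t} (x y : Elem n t) → x ⊆ᴱ y → T (leqB x y)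
leqB⁺ []      []      x⊆y = _
leqB⁺ (A ∷ x) (B ∷ y) x⊆y =
  Equivalence.from T-∧ (subsetB⁺ A B (x⊆y fzero) , leqB⁺ x y (λ j → x⊆y (fsuc j)))

eqE⁻ : ∀ {n t} (x y : Elem n t) → T (eqE x y) → x ≡ y
eqE⁻ []      []      _ = refl
eqE⁻ (A ∷ x) (B ∷ y) h = let A≡B , x≡y = Equivalence.to T-∧ h in cong₂ _∷_ (eqSub⁻ A B A≡B) (eqE⁻ x y x≡y)
  where
  eqSub⁻ : ∀ {n} (A B : Subset n) → T (eqSub A B) → A ≡ B
  eqSub⁻ []          []          _ = refl
  eqSub⁻ (true  ∷ A) (true  ∷ B) h = cong (true ∷_) (eqSub⁻ A B h)
  eqSub⁻ (false ∷ A) (false ∷ B) h = cong (false ∷_) (eqSub⁻ A B h)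

chain⁻ : ∀ {n t} (c : List (Elem n t)) → T (chainB c) →
         All (λ x → T (properB x)) c × Linked (λ x y → T (ltB x y)) c
chain⁻ c h = let proper , increasing′ = Equivalence.to T-∧ h in allL⁻ properB c proper , increasing⁻ c increasing′
  where
  increasing⁻ : ∀ c → T (increasing c) → Linked (λ x y → T (ltB x y)) c
  increasing⁻ []          _ = []
  increasing⁻ (x ∷ [])    _ = [-]
  increasing⁻ (x ∷ y ∷ c) h = let x<y , rest = Equivalence.to T-∧ h in x<y ∷ increasing⁻ (y ∷ c) rest

chain⁺ : ∀ {n t} {c : List (Elem n t)} → All (λ x → T (properB x)) c → Linked (λ x y → T (ltB x y)) c → T (chainB c)
chain⁺ proper increasing′ = Equivalence.from T-∧ (allL⁺ properB proper , increasing⁺ increasing′)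
  where
  increasing⁺ : ∀ {c} → Linked (λ x y → T (ltB x y)) c → T (increasing c)
  increasing⁺ []            = _
  increasing⁺ [-]           = _
  increasing⁺ (x<y ∷ rest) = Equivalence.from T-∧ (x<y , increasing⁺ rest)

chain⇒nested : ∀ {n t} (c : List (Elem n t)) → T (chainB c) → Linked _⊆ᴱ_ c
chain⇒nested c h = Linked.map (λ {x} {y} x<y → leqB⁻ x y (proj₁ (Equivalence.to T-∧ x<y))) (proj₂ (chain⁻ c h))

HasCard : ∀ {n t} → ℕ → Elem n t → Set
HasCard κ x = ∀ j → card (lookup x j) ≡ κ

properB⁻ : ∀ {n t} (x : Elem n t) → T (properB x) → ∃ λ κ → 0 < κ × κ < n × HasCard κ x
properB⁻ {n} x h =
  let κ , h′              = anyL⁻ _ (upTo n) h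
      0<κ , h″            = Equivalence.to T-∧ h′
      κ<n , all≡κ         = Equivalence.to T-∧ h″
  in κ , ℕ.<ᵇ⇒< 0 κ 0<κ , ℕ.<ᵇ⇒< κ n κ<n , λ j → ℕ.≡ᵇ⇒≡ _ κ (allV⁻ (λ A → card A ≡ᵇ κ) x all≡κ j)

properB⁺ : ∀ {n t} (x : Elem n t) {κ} → 0 < κ → κ < n → HasCard κ x → T (properB x)
properB⁺ {n} x {κ} 0<κ κ<n hasCard = anyL⁺ _ (∈-upTo⁺ κ<n)
  (Equivalence.from T-∧ (ℕ.<⇒<ᵇ 0<κ , Equivalence.from T-∧
    (ℕ.<⇒<ᵇ κ<n , allV⁺ (λ A → card A ≡ᵇ κ) x (λ j → ℕ.≡⇒≡ᵇ _ κ (hasCard j)))))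

card-⊆ : ∀ {n} (A B : Subset n) → T (subsetB A B) → card A ≤ card B
card-⊆ []          []          _ = z≤n
card-⊆ (true  ∷ A) (true  ∷ B) h = s≤s (card-⊆ A B h)
card-⊆ (false ∷ A) (true  ∷ B) h = ℕ.m≤n⇒m≤1+n (card-⊆ A B h)
card-⊆ (false ∷ A) (false ∷ B) h = card-⊆ A B h

card-⊂ : ∀ {n} (A B : Subset n) → T (subsetB A B) → T (not (eqSub A B)) → card A < card B
card-⊂ []          []          _ ()
card-⊂ (true  ∷ A) (true  ∷ B) h A≢B = s≤s (card-⊂ A B h A≢B)
card-⊂ (false ∷ A) (true  ∷ B) h _   = s≤s (card-⊆ A B h)
card-⊂ (false ∷ A) (false ∷ B) h A≢B = card-⊂ A B h A≢B

distinctCoordinate : ∀ {n t} (x y : Elem n t) → T (not (eqE x y)) →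
                     ∃ λ j → T (not (eqSub (lookup x j) (lookup y j)))
distinctCoordinate []      []      ()
distinctCoordinate (A ∷ x) (B ∷ y) h with eqSub A B in A≟B
... | false = fzero , Equivalence.from T-not-≡ A≟B
... | true  = let j , x≢y = distinctCoordinate x y h in fsuc j , x≢y

ltB⇒card< : ∀ {n t} (x y : Elem n t) {κ κ′} → T (ltB x y) → HasCard κ x → HasCard κ′ y → κ < κ′
ltB⇒card< x y x<y hasκ hasκ′ =
  let x≤y , x≢y = Equivalence.to T-∧ x<y
      j , xⱼ≢yⱼ  = distinctCoordinate x y x≢y
  in subst₂ _<_ (hasκ j) (hasκ′ j) (card-⊂ (lookup x j) (lookup y j) (leqB-coordinate x y x≤y j) xⱼ≢yⱼ)
  where
  leqB-coordinate : ∀ {n t} (x y : Elem n t) → T (leqB x y) → ∀ j → T (subsetB (lookup x j) (lookup y j))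
  leqB-coordinate (A ∷ x) (B ∷ y) h fzero    = proj₁ (Equivalence.to T-∧ h)
  leqB-coordinate (A ∷ x) (B ∷ y) h (fsuc j) = leqB-coordinate x y (proj₂ (Equivalence.to T-∧ h)) j

CardsFrom : ∀ {n t} → ℕ → List (Elem n t) → Set
CardsFrom k []      = ⊤
CardsFrom k (x ∷ d) = HasCard k x × CardsFrom (suc k) d

CardsIn : ∀ {n t} → ℕ → ℕ → List (Elem n t) → Set
CardsIn lo hi []      = ⊤
CardsIn lo hi (x ∷ d) = ∃ λ κ → lo ≤ κ × κ ≤ hi × HasCard κ x × CardsIn (suc κ) hi d

chain⇒CardsIn : ∀ {n′ t} (d : List (Elem (suc n′) t)) → T (chainB d) → CardsIn 1 n′ d
chain⇒CardsIn []      _ = _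
chain⇒CardsIn (x ∷ d) h with chain⁻ (x ∷ d) h
... | px ∷ proper , increasing′ = let κ , 0<κ , κ<n , hasκ = properB⁻ x px in cardsIn proper increasing′ 0<κ κ<n hasκ
  where
  cardsIn : ∀ {n′ t} {x : Elem (suc n′) t} {d} → All (λ x → T (properB x)) d → Linked (λ x y → T (ltB x y)) (x ∷ d) →
            ∀ {lo κ} → lo ≤ κ → κ < suc n′ → HasCard κ x → CardsIn lo n′ (x ∷ d)
  cardsIn []           [-]               lo≤κ κ<n hasκ = _ , lo≤κ , ℕ.≤-pred κ<n , hasκ , _
  cardsIn {x = x} {y ∷ d} (py ∷ proper) (x<y ∷ increasing′) lo≤κ κ<n hasκ =
    let κ′ , _ , κ′<n , hasκ′ = properB⁻ y py
    in _ , lo≤κ , ℕ.≤-pred κ<n , hasκ , cardsIn proper increasing′ (ltB⇒card< x y x<y hasκ hasκ′) κ′<n hasκ′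

CardsIn-length : ∀ {n t} lo hi (d : List (Elem n t)) → CardsIn lo hi d → lo ≤ suc hi → length d + lo ≤ suc hi
CardsIn-length lo hi []      _                            lo≤ = lo≤
CardsIn-length lo hi (x ∷ d) (κ , lo≤κ , κ≤hi , _ , cards) _  = begin
  suc (length d + lo)  ≡⟨ sym (ℕ.+-suc (length d) lo) ⟩
  length d + suc lo    ≤⟨ ℕ.+-monoʳ-≤ (length d) (s≤s lo≤κ) ⟩
  length d + suc κ     ≤⟨ CardsIn-length (suc κ) hi d cards (s≤s κ≤hi) ⟩
  suc hi               ∎
  where open ℕ.≤-Reasoning

CardsIn⇒CardsFrom : ∀ {n t} lo hi (d : List (Elem n t)) → CardsIn lo hi d → length d + lo ≡ suc hi → CardsFrom lo d
CardsIn⇒CardsFrom lo hi []      _                                 _     = _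
CardsIn⇒CardsFrom lo hi (x ∷ d) (κ , lo≤κ , κ≤hi , hasκ , cards) exact with κ≡lo
  where
  κ≡lo : κ ≡ lo
  κ≡lo = ℕ.≤-antisym (ℕ.≤-pred (ℕ.+-cancelˡ-≤ (length d) (suc κ) (suc lo) (begin
    length d + suc κ   ≤⟨ CardsIn-length (suc κ) hi d cards (s≤s κ≤hi) ⟩
    suc hi             ≡⟨ sym exact ⟩
    suc (length d + lo) ≡⟨ sym (ℕ.+-suc (length d) lo) ⟩
    length d + suc lo  ∎))) lo≤κ
    where open ℕ.≤-Reasoning
... | refl = hasκ , CardsIn⇒CardsFrom (suc κ) hi d cards (≡-trans (ℕ.+-suc (length d) κ) exact)

topChain-cards : ∀ {n′ t} (d : List (Elem (suc n′) t)) → T (chainB d) → length d ≡ n′ → CardsFrom 1 d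
topChain-cards {n′} d h d-length =
  CardsIn⇒CardsFrom 1 n′ d (chain⇒CardsIn d h) (≡-trans (ℕ.+-comm (length d) 1) (cong suc d-length))

-- Top chains and permutations

card≡count : ∀ {n} (A : Subset n) → card A ≡ count (lookup A)
card≡count []          = refl
card≡count (true  ∷ A) = cong suc (card≡count A)
card≡count (false ∷ A) = card≡count A

card-sublevel : ∀ {n t} (ρ : Fin t → Fin n → ℕ) k j → card (lookup (sublevel ρ k) j) ≡ count (λ a → ρ j a ≤ᵇ k)
card-sublevel ρ k j = ≡-trans (card≡count (lookup (sublevel ρ k) j)) (count-cong (lookup-sublevel ρ k j))

CardsFrom-sublevels : ∀ {n t} (ρ : Fin t → Fin n → ℕ) k m → CardsFrom (suc k) (sublevels ρ k m) →
                      ∀ l → k ≤ l → l < k + m → ∀ j → count (λ a → ρ j a ≤ᵇ l) ≡ suc l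
CardsFrom-sublevels ρ k zero    _                l k≤l l<k+0 j =
  ⊥-elim (ℕ.<⇒≱ l<k+0 (ℕ.≤-trans (ℕ.≤-reflexive (ℕ.+-identityʳ k)) k≤l))
CardsFrom-sublevels ρ k (suc m) (hasCard , cards) l k≤l l<k+m j with ℕ.m≤n⇒m<n∨m≡n k≤l
... | inj₂ refl = ≡-trans (sym (card-sublevel ρ k j)) (hasCard j)
... | inj₁ k<l  = CardsFrom-sublevels ρ (suc k) m cards l k<l (subst (l <_) (ℕ.+-suc k m) l<k+m) j

rank≤length : ∀ {n t} (d : List (Elem n t)) j a → rank d j a ≤ length d
rank≤length []      j a = z≤n
rank≤length (x ∷ d) j a with lookup (lookup x j) a
... | true  = ℕ.m≤n⇒m≤1+n (rank≤length d j a)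
... | false = s≤s (rank≤length d j a)

IsRanking : ∀ {n} → ℕ → (Fin n → ℕ) → Set
IsRanking n′ ρ = (∀ k → k ≤ n′ → count (λ a → ρ a ≡ᵇ k) ≡ 1) × (∀ a → ρ a ≤ n′)

CumulativeCounts : ∀ {n} → ℕ → (Fin n → ℕ) → Set
CumulativeCounts n′ ρ = ∀ k → k ≤ n′ → count (λ a → ρ a ≤ᵇ k) ≡ suc k

<ᵇ-suc : ∀ m k → (m <ᵇ suc k) ≡ (m ≤ᵇ k)
<ᵇ-suc zero    k = refl
<ᵇ-suc (suc m) k = refl

indicator-≤ᵇ-suc : ∀ m k → indicator (m ≤ᵇ suc k) ≡ indicator (m ≤ᵇ k) + indicator (m ≡ᵇ suc k)
indicator-≤ᵇ-suc zero    k = refl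
indicator-≤ᵇ-suc (suc m) k = indicator-<ᵇ-suc m k
  where
  indicator-<ᵇ-suc : ∀ m k → indicator (m <ᵇ suc k) ≡ indicator (m <ᵇ k) + indicator (m ≡ᵇ k)
  indicator-<ᵇ-suc zero    zero    = refl
  indicator-<ᵇ-suc zero    (suc k) = refl
  indicator-<ᵇ-suc (suc m) zero    = refl
  indicator-<ᵇ-suc (suc m) (suc k) = indicator-<ᵇ-suc m k

≡ᵇ0≡≤ᵇ0 : ∀ m → (m ≡ᵇ 0) ≡ (m ≤ᵇ 0)
≡ᵇ0≡≤ᵇ0 zero    = refl
≡ᵇ0≡≤ᵇ0 (suc m) = refl

cumulative⇒fibres : ∀ {n} n′ (ρ : Fin n → ℕ) → CumulativeCounts n′ ρ → ∀ k → k ≤ n′ → count (λ a → ρ a ≡ᵇ k) ≡ 1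
cumulative⇒fibres n′ ρ cumulative zero    _     = ≡-trans (count-cong (λ a → ≡ᵇ0≡≤ᵇ0 (ρ a))) (cumulative 0 z≤n)
cumulative⇒fibres n′ ρ cumulative (suc k) k<n′ = ℕ.+-cancelˡ-≡ (suc k) _ 1 (begin
  suc k + count (λ a → ρ a ≡ᵇ suc k)
    ≡⟨ cong (_+ count (λ a → ρ a ≡ᵇ suc k)) (sym (cumulative k (ℕ.<⇒≤ k<n′))) ⟩
  count (λ a → ρ a ≤ᵇ k) + count (λ a → ρ a ≡ᵇ suc k)
    ≡⟨ sym (count-+ (λ a → ρ a ≤ᵇ suc k) _ _ (λ a → indicator-≤ᵇ-suc (ρ a) k)) ⟩
  count (λ a → ρ a ≤ᵇ suc k)
    ≡⟨ cumulative (suc k) k<n′ ⟩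
  suc (suc k)
    ≡⟨ ℕ.+-comm 1 (suc k) ⟩
  suc k + 1 ∎)
  where open ≡-Reasoning

fibres⇒cumulative : ∀ {n} n′ (ρ : Fin n → ℕ) → (∀ k → k ≤ n′ → count (λ a → ρ a ≡ᵇ k) ≡ 1) → CumulativeCounts n′ ρ
fibres⇒cumulative n′ ρ fibres zero    _     = ≡-trans (sym (count-cong (λ a → ≡ᵇ0≡≤ᵇ0 (ρ a)))) (fibres 0 z≤n)
fibres⇒cumulative n′ ρ fibres (suc k) k<n′ = begin
  count (λ a → ρ a ≤ᵇ suc k)
    ≡⟨ count-+ (λ a → ρ a ≤ᵇ suc k) _ _ (λ a → indicator-≤ᵇ-suc (ρ a) k) ⟩
  count (λ a → ρ a ≤ᵇ k) + count (λ a → ρ a ≡ᵇ suc k)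
    ≡⟨ cong₂ _+_ (fibres⇒cumulative n′ ρ fibres k (ℕ.<⇒≤ k<n′)) (fibres (suc k) k<n′) ⟩
  suc k + 1
    ≡⟨ ℕ.+-comm (suc k) 1 ⟩
  suc (suc k) ∎
  where open ≡-Reasoning

≡ᵇ-refl : ∀ m → (m ≡ᵇ m) ≡ true
≡ᵇ-refl m = Equivalence.to T-≡ (ℕ.≡⇒≡ᵇ m m refl)

ranking-injective : ∀ {n} n′ (ρ : Fin n → ℕ) → IsRanking n′ ρ → ∀ {a b} → ρ a ≡ ρ b → a ≡ b
ranking-injective n′ ρ (fibres , bounded) {a} {b} ρa≡ρb =
  count-unique (λ x → ρ x ≡ᵇ ρ a) (fibres (ρ a) (bounded a)) (≡ᵇ-refl (ρ a))
               (≡-trans (cong (_≡ᵇ ρ a) (sym ρa≡ρb)) (≡ᵇ-refl (ρ a)))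

rankingPermutation : ∀ n′ (ρ : Fin (suc n′) → ℕ) → IsRanking n′ ρ →
                     Σ (Permutation′ (suc n′)) λ π → ∀ a → toℕ (π ⟨$⟩ˡ a) ≡ ρ a
rankingPermutation n′ ρ ranking@(fibres , bounded) =
  permutation to from to∘from from∘to , λ a → Fin.toℕ-fromℕ< (s≤s (bounded a))
  where
  from : Fin (suc n′) → Fin (suc n′)
  from a = fromℕ< (s≤s (bounded a))
  preimage : ∀ (k : Fin (suc n′)) → ∃ λ a → (ρ a ≡ᵇ toℕ k) ≡ true
  preimage k = count-witness (λ a → ρ a ≡ᵇ toℕ k) (fibres (toℕ k) (ℕ.≤-pred (Fin.toℕ<n k)))
  to : Fin (suc n′) → Fin (suc n′)
  to k = proj₁ (preimage k)
  ρ∘to : ∀ k → ρ (to k) ≡ toℕ k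
  ρ∘to k = ℕ.≡ᵇ⇒≡ _ _ (Equivalence.from T-≡ (proj₂ (preimage k)))
  from∘to : ∀ k → from (to k) ≡ k
  from∘to k = Fin.toℕ-injective (≡-trans (Fin.toℕ-fromℕ< (s≤s (bounded (to k)))) (ρ∘to k))
  to∘from : ∀ a → to (from a) ≡ a
  to∘from a = ranking-injective n′ ρ ranking (≡-trans (ρ∘to (from a)) (Fin.toℕ-fromℕ< (s≤s (bounded a))))

topChain≡sublevels : ∀ {n′ t} (d : List (Elem (suc n′) t)) → T (chainB d) → length d ≡ n′ →
                     d ≡ sublevels (rank d) 0 n′
topChain≡sublevels {n′} d h d-length = ≡-trans (nested≡sublevels d (chain⇒nested d h) 0) (cong (sublevels (rank d) 0) d-length)

topChain-ranking : ∀ {n′ t} (d : List (Elem (suc n′) t)) → T (chainB d) → length d ≡ n′ → ∀ j → IsRanking n′ (rank d j)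
topChain-ranking {n′} d h d-length j = cumulative⇒fibres n′ (rank d j) cumulative , bounded
  where
  cards : CardsFrom 1 (sublevels (rank d) 0 n′)
  cards = subst (CardsFrom 1) (topChain≡sublevels d h d-length) (topChain-cards d h d-length)
  bounded : ∀ a → rank d j a ≤ n′
  bounded a = subst (rank d j a ≤_) d-length (rank≤length d j a)
  cumulative : CumulativeCounts n′ (rank d j)
  cumulative k k≤n′ with ℕ.m≤n⇒m<n∨m≡n k≤n′
  ... | inj₁ k<n′ = CardsFrom-sublevels (rank d) 0 n′ cards k z≤n k<n′ j
  ... | inj₂ refl = count-all (λ a → rank d j a ≤ᵇ k) (λ a → ≤ᵇ≡true (bounded a))

standardChain : ∀ n′ t → List (Elem (suc n′) t)
standardChain n′ t = sublevels (λ _ a → toℕ a) 0 n′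

topChain≡act-standardChain : ∀ {n′ t} (d : List (Elem (suc n′) t)) → T (chainB d) → length d ≡ n′ →
                             Σ (Group (suc n′) t) λ g → actChain g (standardChain n′ t) ≡ d
topChain≡act-standardChain {n′} {t} d h d-length = g , (begin
  actChain g (standardChain n′ t)
    ≡⟨ actChain-sublevels g (λ _ a → toℕ a) 0 n′ ⟩
  sublevels (λ j a → toℕ (lookup g j ⟨$⟩ˡ a)) 0 n′
    ≡⟨ sublevels-cong 0 n′ (λ l _ → sublevel-cong (λ j a → toℕ (lookup g j ⟨$⟩ˡ a)) (rank d) (λ j a → cong (_≤ᵇ l) (toℕ-g j a))) ⟩
  sublevels (rank d) 0 n′
    ≡⟨ sym (topChain≡sublevels d h d-length) ⟩
  d ∎)
  where
  open ≡-Reasoning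
  π : (j : Fin t) → Σ (Permutation′ (suc n′)) λ π → ∀ a → toℕ (π ⟨$⟩ˡ a) ≡ rank d j a
  π j = rankingPermutation n′ (rank d j) (topChain-ranking d h d-length j)
  g : Group (suc n′) t
  g = tabulate (λ j → proj₁ (π j))
  toℕ-g : ∀ j a → toℕ (lookup g j ⟨$⟩ˡ a) ≡ rank d j a
  toℕ-g j a = ≡-trans (cong (λ σ → toℕ (σ ⟨$⟩ˡ a)) (Vec.lookup∘tabulate (λ j → proj₁ (π j)) j)) (proj₂ (π j) a)

sublevel-proper : ∀ {n′ t} (ρ : Fin t → Fin (suc n′) → ℕ) k → k < n′ →
                  (∀ j → count (λ a → ρ j a ≤ᵇ k) ≡ suc k) → T (properB (sublevel ρ k))
sublevel-proper ρ k k<n′ counts =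
  properB⁺ (sublevel ρ k) (s≤s z≤n) (s≤s k<n′) (λ j → ≡-trans (card-sublevel ρ k j) (counts j))

sublevel-ltB : ∀ {n t′} (ρ : Fin (suc t′) → Fin n → ℕ) k →
               (∀ j → count (λ a → ρ j a ≤ᵇ k) ≡ suc k) → (∀ j → count (λ a → ρ j a ≤ᵇ suc k) ≡ suc (suc k)) →
               T (ltB (sublevel ρ k) (sublevel ρ (suc k)))
sublevel-ltB ρ k counts counts′ = Equivalence.from T-∧ (leqB⁺ (sublevel ρ k) (sublevel ρ (suc k)) ⊆ , distinct)
  where
  ⊆ : sublevel ρ k ⊆ᴱ sublevel ρ (suc k)
  ⊆ j a a∈ = ≡-trans (lookup-sublevel ρ (suc k) j a)
    (≤ᵇ≡true (ℕ.m≤n⇒m≤1+n (ℕ.≤ᵇ⇒≤ (ρ j a) k (Equivalence.from T-≡ (≡-trans (sym (lookup-sublevel ρ k j a)) a∈)))))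
  distinct : T (not (eqE (sublevel ρ k) (sublevel ρ (suc k))))
  distinct with eqE (sublevel ρ k) (sublevel ρ (suc k)) in equal
  ... | false = _
  ... | true  = let sublevels≡ = eqE⁻ (sublevel ρ k) (sublevel ρ (suc k)) (Equivalence.from T-≡ equal) in
    ⊥-elim (ℕ.1+n≢n (sym (begin
    suc k                                             ≡⟨ sym (≡-trans (card-sublevel ρ k fzero) (counts fzero)) ⟩
    card (lookup (sublevel ρ k) fzero)                ≡⟨ cong (λ x → card (lookup x fzero)) sublevels≡ ⟩
    card (lookup (sublevel ρ (suc k)) fzero)          ≡⟨ ≡-trans (card-sublevel ρ (suc k) fzero) (counts′ fzero) ⟩
    suc (suc k)                                       ∎)))
    where open ≡-Reasoning

sublevels-chain : ∀ {n′ t′} (ρ : Fin (suc t′) → Fin (suc n′) → ℕ) →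
                  (∀ j k → k < n′ → count (λ a → ρ j a ≤ᵇ k) ≡ suc k) → T (chainB (sublevels ρ 0 n′))
sublevels-chain {n′} ρ counts = chain⁺ (proper 0 n′ ℕ.≤-refl) (increasing′ 0 n′ ℕ.≤-refl)
  where
  below : ∀ k m → k + suc m ≤ n′ → k < n′ × suc k + m ≤ n′
  below k m k+1+m≤n′ = let k+1+m≡ = ℕ.+-suc k m in
    ℕ.≤-trans (s≤s (ℕ.m≤m+n k m)) (subst (_≤ n′) k+1+m≡ k+1+m≤n′) , subst (_≤ n′) k+1+m≡ k+1+m≤n′
  proper : ∀ k m → k + m ≤ n′ → All (λ x → T (properB x)) (sublevels ρ k m)
  proper k zero    _   = []
  proper k (suc m) ≤n′ = let k<n′ , ≤n′′ = below k m ≤n′ in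
    sublevel-proper ρ k k<n′ (λ j → counts j k k<n′) ∷ proper (suc k) m ≤n′′
  increasing′ : ∀ k m → k + m ≤ n′ → Linked (λ x y → T (ltB x y)) (sublevels ρ k m)
  increasing′ k zero          _   = []
  increasing′ k (suc zero)    _   = [-]
  increasing′ k (suc (suc m)) ≤n′ = let k<n′ , ≤n′′ = below k (suc m) ≤n′ ; k+1<n′ , _ = below (suc k) m ≤n′′ in
    sublevel-ltB ρ k (λ j → counts j k k<n′) (λ j → counts j (suc k) k+1<n′) ∷ increasing′ (suc k) (suc m) ≤n′′

count-toℕ≤ᵇ : ∀ n k → k < n → count {n} (λ a → toℕ a ≤ᵇ k) ≡ suc k
count-toℕ≤ᵇ (suc n) zero    _         = cong suc (count-none {n} (λ a → toℕ a <ᵇ 0) (λ _ → refl))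
count-toℕ≤ᵇ (suc n) (suc k) (s≤s k<n) = cong suc (≡-trans (count-cong {n} (λ a → <ᵇ-suc (toℕ a) k)) (count-toℕ≤ᵇ n k k<n))

standardChain-chain : ∀ n′ t′ → T (chainB (standardChain n′ (suc t′)))
standardChain-chain n′ t′ = sublevels-chain (λ _ a → toℕ a) (λ _ k k<n′ → count-toℕ≤ᵇ (suc n′) k (ℕ.m≤n⇒m≤1+n k<n′))

standardChain-top : ∀ n′ t′ → TopChain (suc n′) (suc t′) (standardChain n′ (suc t′))
standardChain-top n′ t′ = standardChain-chain n′ t′ , length-sublevels (λ _ a → toℕ a) 0 n′

swapAdj : ℕ → ℕ → ℕ
swapAdj zero    zero          = 1
swapAdj zero    (suc zero)    = 0
swapAdj zero    (suc (suc m)) = suc (suc m)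
swapAdj (suc i) zero          = zero
swapAdj (suc i) (suc m)       = suc (swapAdj i m)

swapAdj-<ᵇ : ∀ i p q → ((swapAdj i q <ᵇ swapAdj i p) xor (q <ᵇ p)) ≡
                       ((p ≡ᵇ i) ∧ (q ≡ᵇ suc i)) xor ((p ≡ᵇ suc i) ∧ (q ≡ᵇ i))
swapAdj-<ᵇ zero    zero          zero          = refl
swapAdj-<ᵇ zero    zero          (suc zero)    = refl
swapAdj-<ᵇ zero    zero          (suc (suc q)) = refl
swapAdj-<ᵇ zero    (suc zero)    zero          = refl
swapAdj-<ᵇ zero    (suc zero)    (suc zero)    = refl
swapAdj-<ᵇ zero    (suc zero)    (suc (suc q)) = refl
swapAdj-<ᵇ zero    (suc (suc p)) zero          = refl
swapAdj-<ᵇ zero    (suc (suc p)) (suc zero)    = refl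
swapAdj-<ᵇ zero    (suc (suc p)) (suc (suc q)) = xor-same (q <ᵇ p)
swapAdj-<ᵇ (suc i) zero          zero          = refl
swapAdj-<ᵇ (suc i) zero          (suc q)       = refl
swapAdj-<ᵇ (suc i) (suc p)       zero          = sym (cong₂ _xor_ (∧-zeroʳ (p ≡ᵇ i)) (∧-zeroʳ (p ≡ᵇ suc i)))
swapAdj-<ᵇ (suc i) (suc p)       (suc q)       = swapAdj-<ᵇ i p q

swapAdj-≡ᵇ : ∀ i m k → (swapAdj i m ≡ᵇ k) ≡ (m ≡ᵇ swapAdj i k)
swapAdj-≡ᵇ zero    zero          zero          = refl
swapAdj-≡ᵇ zero    zero          (suc zero)    = refl
swapAdj-≡ᵇ zero    zero          (suc (suc k)) = refl
swapAdj-≡ᵇ zero    (suc zero)    zero          = refl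
swapAdj-≡ᵇ zero    (suc zero)    (suc zero)    = refl
swapAdj-≡ᵇ zero    (suc zero)    (suc (suc k)) = refl
swapAdj-≡ᵇ zero    (suc (suc m)) zero          = refl
swapAdj-≡ᵇ zero    (suc (suc m)) (suc zero)    = refl
swapAdj-≡ᵇ zero    (suc (suc m)) (suc (suc k)) = refl
swapAdj-≡ᵇ (suc i) zero          zero          = refl
swapAdj-≡ᵇ (suc i) zero          (suc k)       = refl
swapAdj-≡ᵇ (suc i) (suc m)       zero          = refl
swapAdj-≡ᵇ (suc i) (suc m)       (suc k)       = swapAdj-≡ᵇ i m k

swapAdj-≤ᵇ : ∀ i m k → k ≢ i → (swapAdj i m ≤ᵇ k) ≡ (m ≤ᵇ k)
swapAdj-≤ᵇ zero    zero          zero    k≢i = ⊥-elim (k≢i refl)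
swapAdj-≤ᵇ zero    zero          (suc k) k≢i = refl
swapAdj-≤ᵇ zero    (suc zero)    zero    k≢i = ⊥-elim (k≢i refl)
swapAdj-≤ᵇ zero    (suc zero)    (suc k) k≢i = refl
swapAdj-≤ᵇ zero    (suc (suc m)) k       k≢i = refl
swapAdj-≤ᵇ (suc i) zero          k       k≢i = refl
swapAdj-≤ᵇ (suc i) (suc m)       zero    k≢i = refl
swapAdj-≤ᵇ (suc i) (suc m)       (suc k) k≢i =
  ≡-trans (<ᵇ-suc (swapAdj i m) k) (≡-trans (swapAdj-≤ᵇ i m k (λ k≡i → k≢i (cong suc k≡i))) (sym (<ᵇ-suc m k)))

swapAdj-≤ : ∀ i k n′ → k ≤ n′ → i < n′ → swapAdj i k ≤ n′
swapAdj-≤ zero    zero          n′       k≤n′      i<n′      = i<n′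
swapAdj-≤ zero    (suc zero)    n′       k≤n′      i<n′      = z≤n
swapAdj-≤ zero    (suc (suc k)) n′       k≤n′      i<n′      = k≤n′
swapAdj-≤ (suc i) zero          n′       k≤n′      i<n′      = z≤n
swapAdj-≤ (suc i) (suc k)       (suc n′) (s≤s k≤n′) (s≤s i<n′) = s≤s (swapAdj-≤ i k n′ k≤n′ i<n′)

≡ᵇ-suc-disjoint : ∀ m i → (m ≡ᵇ i) ∧ (m ≡ᵇ suc i) ≡ false
≡ᵇ-suc-disjoint zero          zero    = refl
≡ᵇ-suc-disjoint zero          (suc i) = refl
≡ᵇ-suc-disjoint (suc zero)    zero    = refl
≡ᵇ-suc-disjoint (suc (suc m)) zero    = refl
≡ᵇ-suc-disjoint (suc m)       (suc i) = ≡ᵇ-suc-disjoint m i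

inversionParity-swapAdj : ∀ {n} (ρ : Fin n → ℕ) i → count (λ a → ρ a ≡ᵇ i) ≡ 1 → count (λ a → ρ a ≡ᵇ suc i) ≡ 1 →
  inversionParity (λ a → swapAdj i (ρ a)) ≡ not (inversionParity ρ)
inversionParity-swapAdj {n} ρ i one-i one-i+1 = xor-moveʳ _ (inversionParity ρ) true (begin
  inversionParity (λ a → swapAdj i (ρ a)) xor inversionParity ρ
    ≡⟨ sym (pairXorSum-xor (λ a b → swapAdj i (ρ b) <ᵇ swapAdj i (ρ a)) (λ a b → ρ b <ᵇ ρ a) (allFin n)) ⟩
  pairXorSum (λ a b → (swapAdj i (ρ b) <ᵇ swapAdj i (ρ a)) xor (ρ b <ᵇ ρ a)) (allFin n)
    ≡⟨ pairXorSum-cong (λ a b → swapAdj-<ᵇ i (ρ a) (ρ b)) (allFin n) ⟩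
  pairXorSum (λ a b → ((ρ a ≡ᵇ i) ∧ (ρ b ≡ᵇ suc i)) xor ((ρ a ≡ᵇ suc i) ∧ (ρ b ≡ᵇ i))) (allFin n)
    ≡⟨ pairXorSum-disjoint (λ a → ρ a ≡ᵇ i) (λ a → ρ a ≡ᵇ suc i) (λ a → ≡ᵇ-suc-disjoint (ρ a) i) (allFin n) ⟩
  xorSum (λ a → ρ a ≡ᵇ i) (allFin n) ∧ xorSum (λ a → ρ a ≡ᵇ suc i) (allFin n)
    ≡⟨ cong₂ _∧_ (≡-trans (xorSum-allFin (λ a → ρ a ≡ᵇ i)) (cong odd one-i))
                 (≡-trans (xorSum-allFin (λ a → ρ a ≡ᵇ suc i)) (cong odd one-i+1)) ⟩
  true ∎)
  where open ≡-Reasoning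

swapAdj-≤ᵇ-below : ∀ {r i} → r ≤ i → (swapAdj i r ≤ᵇ i) ≡ not (r ≡ᵇ i)
swapAdj-≤ᵇ-below {zero}  {zero}  z≤n       = refl
swapAdj-≤ᵇ-below {zero}  {suc i} z≤n       = refl
swapAdj-≤ᵇ-below {suc r} {suc i} (s≤s r≤i) = ≡-trans (<ᵇ-suc (swapAdj i r) i) (swapAdj-≤ᵇ-below r≤i)

swapAdj-≤ᵇ-above : ∀ {i r} → i ≤ r → (swapAdj i (suc r) ≤ᵇ i) ≡ (r ≡ᵇ i)
swapAdj-≤ᵇ-above {zero}  {zero}  z≤n       = refl
swapAdj-≤ᵇ-above {zero}  {suc r} z≤n       = refl
swapAdj-≤ᵇ-above {suc i} {suc r} (s≤s i≤r) = ≡-trans (<ᵇ-suc (swapAdj i (suc r)) i) (swapAdj-≤ᵇ-above i≤r)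

swapAdj-below : ∀ {r i} → r ≤ i → swapAdj i r ≡ indicator (r ≡ᵇ i) + r
swapAdj-below {zero}  {zero}  z≤n       = refl
swapAdj-below {zero}  {suc i} z≤n       = refl
swapAdj-below {suc r} {suc i} (s≤s r≤i) = ≡-trans (cong suc (swapAdj-below r≤i)) (sym (ℕ.+-suc _ r))

swapAdj-above : ∀ {i r} → i ≤ r → swapAdj i (suc r) ≡ indicator (not (r ≡ᵇ i)) + r
swapAdj-above {zero}  {zero}  z≤n       = refl
swapAdj-above {zero}  {suc r} z≤n       = refl
swapAdj-above {suc i} {suc r} (s≤s i≤r) = ≡-trans (cong suc (swapAdj-above i≤r)) (sym (ℕ.+-suc _ r))

-- Toggling the first coordinate of an inserted member

insertAt-injective : ∀ {A : Set} i {x x′ : A} c → insertAt i x c ≡ insertAt i x′ c → x ≡ x′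
insertAt-injective zero    c       eq = List.∷-injectiveˡ eq
insertAt-injective (suc i) []      eq = List.∷-injectiveˡ eq
insertAt-injective (suc i) (y ∷ c) eq = insertAt-injective i c (List.∷-injectiveʳ eq)

insertAt-sublevels : ∀ {n t} i (x : Elem n t) c (ρ ρ′ : Fin t → Fin n → ℕ) k m → i ≤ length c →
  insertAt i x c ≡ sublevels ρ k m → (∀ l → l ≢ k + i → sublevel ρ l ≡ sublevel ρ′ l) →
  insertAt i (sublevel ρ′ (k + i)) c ≡ sublevels ρ′ k m
insertAt-sublevels zero    x c       ρ ρ′ k zero    _         ()  _
insertAt-sublevels zero    x c       ρ ρ′ k (suc m) _         eq  agree = cong₂ _∷_
  (cong (sublevel ρ′) (ℕ.+-identityʳ k))
  (≡-trans (List.∷-injectiveʳ eq)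
           (sublevels-cong (suc k) m (λ l k<l → agree l (λ l≡k+0 → ℕ.<⇒≢ k<l (sym (≡-trans l≡k+0 (ℕ.+-identityʳ k)))))))
insertAt-sublevels (suc i) x []      ρ ρ′ k m       ()
insertAt-sublevels (suc i) x (y ∷ c) ρ ρ′ k zero    _         ()  _
insertAt-sublevels (suc i) x (y ∷ c) ρ ρ′ k (suc m) (s≤s i≤) eq  agree = cong₂ _∷_
  (≡-trans (List.∷-injectiveˡ eq) (agree k (λ k≡ → ℕ.m≢1+m+n k (≡-trans k≡ (ℕ.+-suc k i)))))
  (≡-trans (cong (λ l → insertAt i (sublevel ρ′ l) c) (ℕ.+-suc k i))
           (insertAt-sublevels i x c ρ ρ′ (suc k) m i≤ (List.∷-injectiveʳ eq)
                               (λ l l≢ → agree l (λ l≡ → l≢ (≡-trans l≡ (ℕ.+-suc k i))))))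

-- In a chain c missing one level, the first coordinates of the members at positions i - 1 and i
-- differ by exactly two points, namely those of rank i.
gap : ∀ {n t′} → List (Elem n (suc t′)) → ℕ → Subset n
gap c i = tabulate (λ a → rank c fzero a ≡ᵇ i)

toggle : ∀ {n t′} → List (Elem n (suc t′)) → ℕ → Subset n → Subset n
toggle c i A = zipWith _xor_ A (gap c i)

lookup-toggle : ∀ {n t′} (c : List (Elem n (suc t′))) i A a →
                lookup (toggle c i A) a ≡ lookup A a xor (rank c fzero a ≡ᵇ i)
lookup-toggle c i A a =
  ≡-trans (Vec.lookup-zipWith _xor_ a A (gap c i)) (cong (lookup A a xor_) (Vec.lookup∘tabulate _ a))

toggle-involutive : ∀ {n t′} (c : List (Elem n (suc t′))) i A → toggle c i (toggle c i A) ≡ A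
toggle-involutive c i A = lookup-ext λ a → begin
  lookup (toggle c i (toggle c i A)) a                      ≡⟨ lookup-toggle c i (toggle c i A) a ⟩
  lookup (toggle c i A) a xor (rank c fzero a ≡ᵇ i)          ≡⟨ cong (_xor (rank c fzero a ≡ᵇ i)) (lookup-toggle c i A a) ⟩
  (lookup A a xor (rank c fzero a ≡ᵇ i)) xor (rank c fzero a ≡ᵇ i) ≡⟨ sym (xor-moveʳ (lookup A a) _ _ refl) ⟩
  lookup A a                                                ∎
  where open ≡-Reasoning

-- b is the membership of a point in the inserted first coordinate A and r its rank in c; the
-- hypothesis says that A is the i-th sublevel of the rank function of the completed chain.
toggle-level : ∀ b r i → b ≡ (indicator (not b) + r ≤ᵇ i) →
               (swapAdj i (indicator (not b) + r) ≤ᵇ i) ≡ (b xor (r ≡ᵇ i))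
toggle-level true  r i level = swapAdj-≤ᵇ-below (ℕ.≤ᵇ⇒≤ r i (Equivalence.from T-≡ (sym level)))
toggle-level false r i level = swapAdj-≤ᵇ-above (ℕ.≤-pred (≤ᵇ≡false⇒> (suc r) i (sym level)))

toggle-rank : ∀ b r i → b ≡ (indicator (not b) + r ≤ᵇ i) →
              indicator (not (b xor (r ≡ᵇ i))) + r ≡ swapAdj i (indicator (not b) + r)
toggle-rank true  r i level = ≡-trans (cong (λ b → indicator b + r) (not-involutive (r ≡ᵇ i)))
                                      (sym (swapAdj-below (ℕ.≤ᵇ⇒≤ r i (Equivalence.from T-≡ (sym level)))))
toggle-rank false r i level = sym (swapAdj-above (ℕ.≤-pred (≤ᵇ≡false⇒> (suc r) i (sym level))))

module _ {n′ t′} (c : List (Elem (suc n′) (suc t′))) (i : ℕ) (A : Subset (suc n′)) (y : Elem (suc n′) t′)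
         (c-length : suc (length c) ≡ n′) (i≤ : i ≤ length c) (chain : T (chainB (insertAt i (A ∷ y) c))) where

  private
    d : List (Elem (suc n′) (suc t′))
    d = insertAt i (A ∷ y) c

    d-length : length d ≡ n′
    d-length = ≡-trans (length-insertAt i (A ∷ y) c) c-length

    i<n′ : i < n′
    i<n′ = subst (i <_) c-length (s≤s i≤)

    ρ : Fin (suc t′) → Fin (suc n′) → ℕ
    ρ = rank d

    d≡ : d ≡ sublevels ρ 0 n′
    d≡ = topChain≡sublevels d chain d-length

    ρ-ranking : ∀ j → IsRanking n′ (ρ j)
    ρ-ranking = topChain-ranking d chain d-length

    A∷y≡ : A ∷ y ≡ sublevel ρ i
    A∷y≡ = sym (insertAt-injective i c (≡-trans (insertAt-sublevels i (A ∷ y) c ρ ρ 0 n′ i≤ d≡ (λ _ _ → refl)) (sym d≡)))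

    level : ∀ a → lookup A a ≡ (indicator (not (lookup A a)) + rank c fzero a ≤ᵇ i)
    level a = begin
      lookup A a                                          ≡⟨ cong (λ x → lookup (lookup x fzero) a) A∷y≡ ⟩
      lookup (lookup (sublevel ρ i) fzero) a              ≡⟨ lookup-sublevel ρ i fzero a ⟩
      (ρ fzero a ≤ᵇ i)                                    ≡⟨ cong (_≤ᵇ i) (rank-insertAt i (A ∷ y) c fzero a) ⟩
      (indicator (not (lookup A a)) + rank c fzero a ≤ᵇ i) ∎
      where open ≡-Reasoning

    ρ′ : Fin (suc t′) → Fin (suc n′) → ℕ
    ρ′ fzero    a = swapAdj i (ρ fzero a)
    ρ′ (fsuc j) a = ρ (fsuc j) a

    toggled≡ : toggle c i A ∷ y ≡ sublevel ρ′ i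
    toggled≡ = cong₂ _∷_ (lookup-ext λ a → begin
      lookup (toggle c i A) a
        ≡⟨ lookup-toggle c i A a ⟩
      lookup A a xor (rank c fzero a ≡ᵇ i)
        ≡⟨ sym (toggle-level _ _ i (level a)) ⟩
      (swapAdj i (indicator (not (lookup A a)) + rank c fzero a) ≤ᵇ i)
        ≡⟨ cong (λ r → swapAdj i r ≤ᵇ i) (sym (rank-insertAt i (A ∷ y) c fzero a)) ⟩
      (ρ′ fzero a ≤ᵇ i)
        ≡⟨ sym (lookup-sublevel ρ′ i fzero a) ⟩
      lookup (lookup (sublevel ρ′ i) fzero) a ∎)
      (Vec.∷-injectiveʳ A∷y≡)
      where open ≡-Reasoning

    ρ′-fibres : ∀ j k → k ≤ n′ → count (λ a → ρ′ j a ≡ᵇ k) ≡ 1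
    ρ′-fibres fzero    k k≤n′ = ≡-trans (count-cong (λ a → swapAdj-≡ᵇ i (ρ fzero a) k))
                                        (proj₁ (ρ-ranking fzero) (swapAdj i k) (swapAdj-≤ i k n′ k≤n′ i<n′))
    ρ′-fibres (fsuc j) = proj₁ (ρ-ranking (fsuc j))

  toggle-sublevels : insertAt i (toggle c i A ∷ y) c ≡ sublevels ρ′ 0 n′
  toggle-sublevels = ≡-trans (cong (λ x → insertAt i x c) toggled≡) (insertAt-sublevels i (A ∷ y) c ρ ρ′ 0 n′ i≤ d≡ agree)
    where
    agree : ∀ l → l ≢ i → sublevel ρ l ≡ sublevel ρ′ l
    agree l l≢i = sublevel-cong ρ ρ′ λ where
      fzero    a → sym (swapAdj-≤ᵇ i (ρ fzero a) l l≢i)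
      (fsuc j) a → refl

  toggle-chain : T (chainB (insertAt i (toggle c i A ∷ y) c))
  toggle-chain = subst (λ d′ → T (chainB d′)) (sym toggle-sublevels)
    (sublevels-chain ρ′ (λ j k k<n′ → fibres⇒cumulative n′ (ρ′ j) (ρ′-fibres j) k (ℕ.<⇒≤ k<n′)))

  toggle-chainParity : chainParity (insertAt i (toggle c i A ∷ y) c) ≡ not (chainParity d)
  toggle-chainParity = begin
    chainParity d′
      ≡⟨ xorSum-allFin-suc (λ j → inversionParity (rank d′ j)) ⟩
    inversionParity (rank d′ fzero) xor xorSum (λ j → inversionParity (rank d′ (fsuc j))) (allFin t′)
      ≡⟨ cong₂ _xor_ (≡-trans (pairXorSum-cong (λ a b → cong₂ _<ᵇ_ (rank′-first b) (rank′-first a)) (allFin (suc n′)))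
                              (inversionParity-swapAdj (ρ fzero) i (proj₁ (ρ-ranking fzero) i (ℕ.<⇒≤ i<n′))
                                                                   (proj₁ (ρ-ranking fzero) (suc i) i<n′)))
                     (xorSum-cong (λ j → pairXorSum-cong (λ a b → cong₂ _<ᵇ_ (rank′-rest j b) (rank′-rest j a)) (allFin (suc n′))) (allFin t′)) ⟩
    not (inversionParity (ρ fzero)) xor xorSum (λ j → inversionParity (ρ (fsuc j))) (allFin t′)
      ≡⟨ sym (not-distribˡ-xor (inversionParity (ρ fzero)) _) ⟩
    not (inversionParity (ρ fzero) xor xorSum (λ j → inversionParity (ρ (fsuc j))) (allFin t′))
      ≡⟨ cong not (sym (xorSum-allFin-suc (λ j → inversionParity (ρ j)))) ⟩
    not (chainParity d) ∎
    where
    open ≡-Reasoning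
    d′ : List (Elem (suc n′) (suc t′))
    d′ = insertAt i (toggle c i A ∷ y) c
    rank′-first : ∀ a → rank d′ fzero a ≡ swapAdj i (ρ fzero a)
    rank′-first a = begin
      rank d′ fzero a
        ≡⟨ rank-insertAt i (toggle c i A ∷ y) c fzero a ⟩
      indicator (not (lookup (toggle c i A) a)) + rank c fzero a
        ≡⟨ cong (λ b → indicator (not b) + rank c fzero a) (lookup-toggle c i A a) ⟩
      indicator (not (lookup A a xor (rank c fzero a ≡ᵇ i))) + rank c fzero a
        ≡⟨ toggle-rank _ _ i (level a) ⟩
      swapAdj i (indicator (not (lookup A a)) + rank c fzero a)
        ≡⟨ cong (swapAdj i) (sym (rank-insertAt i (A ∷ y) c fzero a)) ⟩
      swapAdj i (ρ fzero a) ∎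
    rank′-rest : ∀ j a → rank d′ (fsuc j) a ≡ ρ (fsuc j) a
    rank′-rest j a = ≡-trans (rank-insertAt i (toggle c i A ∷ y) c (fsuc j) a) (sym (rank-insertAt i (A ∷ y) c (fsuc j) a))

sum-++ : (xs ys : List ℚ) → sumℚ (xs ++ ys) ≡ sumℚ xs ℚ.+ sumℚ ys
sum-++ []       ys = sym (ℚ.+-identityˡ (sumℚ ys))
sum-++ (x ∷ xs) ys = ≡-trans (cong (x ℚ.+_) (sum-++ xs ys)) (sym (ℚ.+-assoc x (sumℚ xs) (sumℚ ys)))

sum-concatMap : {A : Set} (g : A → List ℚ) (xs : List A) → sumℚ (concatMap g xs) ≡ sumℚ (map (λ x → sumℚ (g x)) xs)
sum-concatMap g []       = refl
sum-concatMap g (x ∷ xs) = ≡-trans (sum-++ (g x) (concatMap g xs)) (cong (sumℚ (g x) ℚ.+_) (sum-concatMap g xs))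

sum-cong : {A : Set} {f g : A → ℚ} → (∀ x → f x ≡ g x) → (xs : List A) → sumℚ (map f xs) ≡ sumℚ (map g xs)
sum-cong f≡g []       = refl
sum-cong f≡g (x ∷ xs) = cong₂ ℚ._+_ (f≡g x) (sum-cong f≡g xs)

sum-zero : {A : Set} (f : A → ℚ) (xs : List A) → (∀ {x} → x ∈ xs → f x ≡ 0ℚ) → sumℚ (map f xs) ≡ 0ℚ
sum-zero f []       f≡0 = refl
sum-zero f (x ∷ xs) f≡0 = cong₂ ℚ._+_ (f≡0 (here refl)) (sum-zero f xs (λ x∈ → f≡0 (there x∈)))

sum-neg : {A : Set} (f : A → ℚ) (xs : List A) → sumℚ (map (λ x → - f x) xs) ≡ - sumℚ (map f xs)
sum-neg f []       = refl
sum-neg f (x ∷ xs) = ≡-trans (cong (- f x ℚ.+_) (sum-neg f xs)) (sym (ℚ.neg-distrib-+ (f x) (sumℚ (map f xs))))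

sum-allElems-suc : ∀ {n t} (f : Elem n (suc t) → ℚ) →
  sumℚ (map f (allElems n (suc t))) ≡ sumℚ (map (λ A → sumℚ (map (λ y → f (A ∷ y)) (allElems n t))) (allSubsets n))
sum-allElems-suc {n} {t} f = begin
  sumℚ (map f (concatMap (λ A → map (A ∷_) (allElems n t)) (allSubsets n)))
    ≡⟨ cong sumℚ (List.map-concatMap f (λ A → map (A ∷_) (allElems n t)) (allSubsets n)) ⟩
  sumℚ (concatMap (λ A → map f (map (A ∷_) (allElems n t))) (allSubsets n))
    ≡⟨ sum-concatMap (λ A → map f (map (A ∷_) (allElems n t))) (allSubsets n) ⟩
  sumℚ (map (λ A → sumℚ (map f (map (A ∷_) (allElems n t)))) (allSubsets n))
    ≡⟨ sum-cong (λ A → cong sumℚ (sym (List.map-∘ (allElems n t)))) (allSubsets n) ⟩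
  sumℚ (map (λ A → sumℚ (map (λ y → f (A ∷ y)) (allElems n t))) (allSubsets n)) ∎
  where open ≡-Reasoning

sum-allSubsets-suc : ∀ {n} (G : Subset (suc n) → ℚ) →
  sumℚ (map G (allSubsets (suc n))) ≡
  sumℚ (map (λ A → G (true ∷ A)) (allSubsets n)) ℚ.+ sumℚ (map (λ A → G (false ∷ A)) (allSubsets n))
sum-allSubsets-suc {n} G = begin
  sumℚ (map G (map (true ∷_) (allSubsets n) ++ map (false ∷_) (allSubsets n)))
    ≡⟨ cong sumℚ (List.map-++ G (map (true ∷_) (allSubsets n)) _) ⟩
  sumℚ (map G (map (true ∷_) (allSubsets n)) ++ map G (map (false ∷_) (allSubsets n)))
    ≡⟨ sum-++ (map G (map (true ∷_) (allSubsets n))) _ ⟩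
  sumℚ (map G (map (true ∷_) (allSubsets n))) ℚ.+ sumℚ (map G (map (false ∷_) (allSubsets n)))
    ≡⟨ cong₂ ℚ._+_ (cong sumℚ (sym (List.map-∘ (allSubsets n)))) (cong sumℚ (sym (List.map-∘ (allSubsets n)))) ⟩
  sumℚ (map (λ A → G (true ∷ A)) (allSubsets n)) ℚ.+ sumℚ (map (λ A → G (false ∷ A)) (allSubsets n)) ∎
  where open ≡-Reasoning

sum-allSubsets-xor : ∀ n (G : Subset n → ℚ) (M : Subset n) →
  sumℚ (map G (allSubsets n)) ≡ sumℚ (map (λ A → G (zipWith _xor_ A M)) (allSubsets n))
sum-allSubsets-xor zero    G []      = refl
sum-allSubsets-xor (suc n) G (m ∷ M) = begin
  sumℚ (map G (allSubsets (suc n)))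
    ≡⟨ sum-allSubsets-suc G ⟩
  sumℚ (map (λ A → G (true ∷ A)) (allSubsets n)) ℚ.+ sumℚ (map (λ A → G (false ∷ A)) (allSubsets n))
    ≡⟨ cong₂ ℚ._+_ (sum-allSubsets-xor n (λ A → G (true ∷ A)) M) (sum-allSubsets-xor n (λ A → G (false ∷ A)) M) ⟩
  Σ⊕ true ℚ.+ Σ⊕ false
    ≡⟨ swap-if m ⟩
  Σ⊕ (true xor m) ℚ.+ Σ⊕ (false xor m)
    ≡⟨ sym (sum-allSubsets-suc (λ A → G (zipWith _xor_ A (m ∷ M)))) ⟩
  sumℚ (map (λ A → G (zipWith _xor_ A (m ∷ M))) (allSubsets (suc n))) ∎
  where
  open ≡-Reasoning
  Σ⊕ : Bool → ℚ
  Σ⊕ b = sumℚ (map (λ A → G (b ∷ zipWith _xor_ A M)) (allSubsets n))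
  swap-if : ∀ m → Σ⊕ true ℚ.+ Σ⊕ false ≡ Σ⊕ (true xor m) ℚ.+ Σ⊕ (false xor m)
  swap-if true  = ℚ.+-comm (Σ⊕ true) (Σ⊕ false)
  swap-if false = refl

self-neg⇒0 : ∀ s → s ≡ - s → s ≡ 0ℚ
self-neg⇒0 s s≡-s = begin
  s                                ≡⟨ sym (ℚ.*-identityˡ s) ⟩
  ℚ.½ ℚ.* (1ℚ ℚ.+ 1ℚ) ℚ.* s        ≡⟨ ℚ.*-assoc ℚ.½ (1ℚ ℚ.+ 1ℚ) s ⟩
  ℚ.½ ℚ.* ((1ℚ ℚ.+ 1ℚ) ℚ.* s)      ≡⟨ cong (ℚ.½ ℚ.*_) (ℚ.*-distribʳ-+ s 1ℚ 1ℚ) ⟩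
  ℚ.½ ℚ.* (1ℚ ℚ.* s ℚ.+ 1ℚ ℚ.* s)  ≡⟨ cong (λ r → ℚ.½ ℚ.* (r ℚ.+ r)) (ℚ.*-identityˡ s) ⟩
  ℚ.½ ℚ.* (s ℚ.+ s)                ≡⟨ cong (λ r → ℚ.½ ℚ.* (s ℚ.+ r)) s≡-s ⟩
  ℚ.½ ℚ.* (s ℚ.+ - s)              ≡⟨ cong (ℚ.½ ℚ.*_) (ℚ.+-inverseʳ s) ⟩
  ℚ.½ ℚ.* 0ℚ                       ≡⟨ ℚ.*-zeroʳ ℚ.½ ⟩
  0ℚ                               ∎
  where open ≡-Reasoning


allSubsets-complete : ∀ {n} (A : Subset n) → A ∈ allSubsets n
allSubsets-complete []          = here refl
allSubsets-complete {suc n} (true  ∷ A) = ∈-++⁺ˡ (∈-map⁺ (true ∷_) (allSubsets-complete A))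
allSubsets-complete {suc n} (false ∷ A) = ∈-++⁺ʳ (map (true ∷_) (allSubsets n)) (∈-map⁺ (false ∷_) (allSubsets-complete A))

allElems-complete : ∀ {n t} (x : Elem n t) → x ∈ allElems n t
allElems-complete []      = here refl
allElems-complete {n} {suc t} (A ∷ x) =
  ∈-concatMap⁺ (λ B → map (B ∷_) (allElems n t)) (lose (allSubsets-complete A) (∈-map⁺ (A ∷_) (allElems-complete x)))

sum-nonneg : {A : Set} (f : A → ℚ) → (∀ x → 0ℚ ℚ.≤ f x) → (xs : List A) → 0ℚ ℚ.≤ sumℚ (map f xs)
sum-nonneg f f≥0 []       = ℚ.≤-refl
sum-nonneg f f≥0 (x ∷ xs) = ℚ.+-mono-≤ (f≥0 x) (sum-nonneg f f≥0 xs)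

sum-pos : {A : Set} (f : A → ℚ) → (∀ x → 0ℚ ℚ.≤ f x) → ∀ {x₀ xs} → x₀ ∈ xs → 0ℚ ℚ.< f x₀ → 0ℚ ℚ.< sumℚ (map f xs)
sum-pos f f≥0 {xs = x ∷ xs} (here refl) fx>0 = ℚ.+-mono-<-≤ fx>0 (sum-nonneg f f≥0 xs)
sum-pos f f≥0 {xs = x ∷ xs} (there x₀∈) fx>0 = ℚ.+-mono-≤-< (f≥0 x) (sum-pos f f≥0 x₀∈ fx>0)

-- All terms have the sign of α, and one of them is α.
sum-0-or-α≢0 : {A : Set} (f : A → ℚ) (α : ℚ) → α ≢ 0ℚ → (∀ x → f x ≡ 0ℚ ⊎ f x ≡ α) →
               ∀ {x₀ xs} → x₀ ∈ xs → f x₀ ≡ α → sumℚ (map f xs) ≢ 0ℚ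
sum-0-or-α≢0 f α α≢0 0-or-α {x₀} {xs} x₀∈ fx₀≡α with ℚ.<-cmp 0ℚ α
... | tri≈ _ 0≡α _ = ⊥-elim (α≢0 (sym 0≡α))
... | tri< 0<α _ _ = λ sum≡0 → ℚ.<⇒≢ (sum-pos f f≥0 x₀∈ (subst (0ℚ ℚ.<_) (sym fx₀≡α) 0<α)) (sym sum≡0)
  where
  f≥0 : ∀ x → 0ℚ ℚ.≤ f x
  f≥0 x with 0-or-α x
  ... | inj₁ fx≡0 = ℚ.≤-reflexive (sym fx≡0)
  ... | inj₂ fx≡α = subst (0ℚ ℚ.≤_) (sym fx≡α) (ℚ.<⇒≤ 0<α)
... | tri> _ _ α<0 = λ sum≡0 → ℚ.<⇒≢ (subst (0ℚ ℚ.<_) (sum-neg f xs) -sum>0) (sym (cong -_ sum≡0))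
  where
  -f≥0 : ∀ x → 0ℚ ℚ.≤ - f x
  -f≥0 x with 0-or-α x
  ... | inj₁ fx≡0 = ℚ.≤-reflexive (sym (cong -_ fx≡0))
  ... | inj₂ fx≡α = subst (λ q → 0ℚ ℚ.≤ - q) (sym fx≡α) (ℚ.<⇒≤ (ℚ.neg-antimono-< α<0))
  -sum>0 : 0ℚ ℚ.< sumℚ (map (λ x → - f x) xs)
  -sum>0 = sum-pos (λ x → - f x) -f≥0 x₀∈ (subst (λ q → 0ℚ ℚ.< - q) (sym fx₀≡α) (ℚ.neg-antimono-< α<0))

chain-tail : ∀ {n t} (x : Elem n t) c → T (chainB (x ∷ c)) → T (chainB c)
chain-tail x c h = let proper , increasing′ = chain⁻ (x ∷ c) h in chain⁺ (All.tail proper) (Linked.tail increasing′)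

boundaryTerm : ∀ {n t} → (List (Elem n t) → ℚ) → List (Elem n t) → ℕ → Elem n t → ℚ
boundaryTerm v c i x = if chainB (insertAt i x c) then signℕ i ℚ.* v (insertAt i x c) else 0ℚ

boundaryAt-levels : ∀ {n t} (v : List (Elem n t) → ℚ) c →
  boundaryAt v c ≡ sumℚ (map (λ i → sumℚ (map (boundaryTerm v c i) (allElems n t))) (upTo (suc (length c))))
boundaryAt-levels {n} {t} v c = sum-concatMap (λ i → map (boundaryTerm v c i) (allElems n t)) (upTo (suc (length c)))

-- Toggling the first coordinate is an involution on the insertions at level i that reverses the sign.
signCycle-isTopCycle : ∀ n′ t′ → IsTopCycle (suc n′) (suc t′) signCycle
signCycle-isTopCycle n′ t′ c _ c-length = ≡-trans (boundaryAt-levels signCycle c)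
  (sum-zero _ (upTo (suc (length c))) (λ i∈ → level-sum≡0 _ (ℕ.≤-pred (∈-upTo⁻ i∈))))
  where
  level-sum≡0 : ∀ i → i ≤ length c → sumℚ (map (boundaryTerm signCycle c i) (allElems (suc n′) (suc t′))) ≡ 0ℚ
  level-sum≡0 i i≤ = self-neg⇒0 _ (begin
    sumℚ (map term (allElems (suc n′) (suc t′)))        ≡⟨ sum-allElems-suc term ⟩
    sumℚ (map G (allSubsets (suc n′)))                   ≡⟨ sum-allSubsets-xor (suc n′) G (gap c i) ⟩
    sumℚ (map (λ A → G (toggle c i A)) (allSubsets (suc n′))) ≡⟨ sum-cong G-toggle (allSubsets (suc n′)) ⟩
    sumℚ (map (λ A → - G A) (allSubsets (suc n′)))       ≡⟨ sum-neg G (allSubsets (suc n′)) ⟩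
    - sumℚ (map G (allSubsets (suc n′)))                 ≡⟨ cong -_ (sym (sum-allElems-suc term)) ⟩
    - sumℚ (map term (allElems (suc n′) (suc t′)))      ∎)
    where
    open ≡-Reasoning
    term : Elem (suc n′) (suc t′) → ℚ
    term = boundaryTerm signCycle c i
    G : Subset (suc n′) → ℚ
    G A = sumℚ (map (λ y → term (A ∷ y)) (allElems (suc n′) t′))
    term-toggle : ∀ A y → term (toggle c i A ∷ y) ≡ - term (A ∷ y)
    term-toggle A y with chainB (insertAt i (A ∷ y) c) in chain | chainB (insertAt i (toggle c i A ∷ y) c) in chain′
    ... | true  | true  = ≡-trans
      (cong (signℕ i ℚ.*_) (≡-trans (cong sign (toggle-chainParity c i A y c-length i≤ (Equivalence.from T-≡ chain)))
                                    (sign-not (chainParity (insertAt i (A ∷ y) c)))))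
      (sym (ℚ.neg-distribʳ-* (signℕ i) (signCycle (insertAt i (A ∷ y) c))))
    ... | true  | false = ⊥-elim (subst T chain′ (toggle-chain c i A y c-length i≤ (Equivalence.from T-≡ chain)))
    ... | false | true  = ⊥-elim (subst T chain (subst (λ B → T (chainB (insertAt i (B ∷ y) c))) (toggle-involutive c i A)
                                   (toggle-chain c i (toggle c i A) y c-length i≤ (Equivalence.from T-≡ chain′))))
    ... | false | false = refl
    G-toggle : ∀ A → G (toggle c i A) ≡ - G A
    G-toggle A = ≡-trans (sum-cong (term-toggle A) (allElems (suc n′) t′)) (sum-neg (λ y → term (A ∷ y)) (allElems (suc n′) t′))

isotypic-value : ∀ {n′ t′} (χ : Group (suc n′) (suc t′) → ℚ) c → TopChain (suc n′) (suc t′) c →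
  Σ (Group (suc n′) (suc t′)) λ g → ∀ {w} → IsχCycle (suc n′) (suc t′) χ w → w c ≡ χ g ℚ.* w (standardChain n′ (suc t′))
isotypic-value {n′} {t′} χ c (c-chain , c-length) =
  let g , g·c₀≡c = topChain≡act-standardChain c c-chain c-length
  in g , λ {w} (_ , equivariant) →
       ≡-trans (cong w (sym g·c₀≡c)) (equivariant g (standardChain n′ (suc t′)) (standardChain-top n′ t′))

isotypic-proportional : ∀ {n′ t′} (χ : Group (suc n′) (suc t′) → ℚ) v w →
  IsχCycle (suc n′) (suc t′) χ v → NonZeroChain (suc n′) (suc t′) v → IsχCycle (suc n′) (suc t′) χ w →
  ∃ λ (λ′ : ℚ) → ∀ c → TopChain (suc n′) (suc t′) c → w c ≡ λ′ ℚ.* v c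
isotypic-proportional {n′} {t′} χ v w v-isotypic (c₁ , c₁-top , v₁≢0) w-isotypic = λ′ , proportional
  where
  c₀ : List (Elem (suc n′) (suc t′))
  c₀ = standardChain n′ (suc t′)
  v₀≢0 : v c₀ ≢ 0ℚ
  v₀≢0 v₀≡0 = let g , value = isotypic-value χ c₁ c₁-top in
    v₁≢0 (≡-trans (value v-isotypic) (≡-trans (cong (χ g ℚ.*_) v₀≡0) (ℚ.*-zeroʳ (χ g))))
  instance
    v₀-nonZero : ℚ.NonZero (v c₀)
    v₀-nonZero = ℚ.≢-nonZero v₀≢0
  λ′ : ℚ
  λ′ = w c₀ ℚ.* ℚ.1/ v c₀
  λ′v₀≡w₀ : λ′ ℚ.* v c₀ ≡ w c₀
  λ′v₀≡w₀ = ≡-trans (ℚ.*-assoc (w c₀) (ℚ.1/ v c₀) (v c₀))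
                    (≡-trans (cong (w c₀ ℚ.*_) (ℚ.*-inverseˡ (v c₀))) (ℚ.*-identityʳ (w c₀)))
  proportional : ∀ c → TopChain (suc n′) (suc t′) c → w c ≡ λ′ ℚ.* v c
  proportional c c-top = let g , value = isotypic-value χ c c-top in begin
    w c                        ≡⟨ value w-isotypic ⟩
    χ g ℚ.* w c₀               ≡⟨ cong (χ g ℚ.*_) (sym λ′v₀≡w₀) ⟩
    χ g ℚ.* (λ′ ℚ.* v c₀)      ≡⟨ x∙yz≈y∙xzℚ (χ g) λ′ (v c₀) ⟩
    λ′ ℚ.* (χ g ℚ.* v c₀)      ≡⟨ cong (λ′ ℚ.*_) (sym (value v-isotypic)) ⟩
    λ′ ℚ.* v c                 ∎
    where open ≡-Reasoning

sign-multiplicity1 : ∀ n′ t′ → Multiplicity1 (suc n′) (suc t′) signχ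
sign-multiplicity1 n′ t′ =
  (signCycle , (signCycle-isTopCycle n′ t′ , equivariant) ,
   standardChain n′ (suc t′) , standardChain-top n′ t′ , sign≢0 (chainParity (standardChain n′ (suc t′)))) ,
  isotypic-proportional signχ
  where
  equivariant : ∀ g c → TopChain (suc n′) (suc t′) c → signCycle (actChain g c) ≡ signχ g ℚ.* signCycle c
  equivariant g c (c-chain , c-length) =
    signCycle-actChain g c (λ j → ranking-injective n′ (rank c j) (topChain-ranking c c-chain c-length j))

-- For n = 1 the only top chain is the empty one.
trivial-multiplicity1 : ∀ t′ → Multiplicity1 1 (suc t′) trivialχ
trivial-multiplicity1 t′ =
  ((λ _ → 1ℚ) , ((λ _ _ ()) , (λ _ _ _ → refl)) , [] , (_ , refl) , λ ()) ,
  isotypic-proportional trivialχ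

standardChainTail : ∀ n″ t → List (Elem (suc (suc n″)) t)
standardChainTail n″ t = sublevels (λ _ a → toℕ a) 1 n″

-- Top chains start at cardinality 1, so nothing fits below a member of cardinality 2.
insertAbove-notChain : ∀ {t′} n″ k (x : Elem (suc (suc n″)) (suc t′)) → k < n″ →
                       T (chainB (insertAt (suc k) x (standardChainTail n″ (suc t′)))) → ⊥
insertAbove-notChain {t′} (suc m) k x _ chain = ℕ.1+n≢n (begin
  2                                             ≡⟨ sym (count-toℕ≤ᵇ (suc (suc (suc m))) 1 (s≤s (s≤s z≤n))) ⟩
  count {suc (suc (suc m))} (λ a → toℕ a ≤ᵇ 1) ≡⟨ sym (card-sublevel ρ₀ 1 fzero) ⟩
  card (lookup (sublevel ρ₀ 1) fzero)           ≡⟨ proj₁ (topChain-cards d chain d-length) fzero ⟩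
  1                                             ∎)
  where
  open ≡-Reasoning
  ρ₀ : Fin (suc t′) → Fin (suc (suc (suc m))) → ℕ
  ρ₀ _ a = toℕ a
  d : List (Elem (suc (suc (suc m))) (suc t′))
  d = insertAt (suc k) x (sublevels ρ₀ 1 (suc m))
  d-length : length d ≡ suc (suc m)
  d-length = cong suc (≡-trans (length-insertAt k x (sublevels ρ₀ 2 m)) (cong suc (length-sublevels ρ₀ 2 m)))

boundaryAt-standardChainTail : ∀ n″ t′ (v : List (Elem (suc (suc n″)) (suc t′)) → ℚ) →
  boundaryAt v (standardChainTail n″ (suc t′)) ≡
  sumℚ (map (boundaryTerm v (standardChainTail n″ (suc t′)) 0) (allElems (suc (suc n″)) (suc t′)))
boundaryAt-standardChainTail n″ t′ v = begin
  boundaryAt v c′                                                 ≡⟨ boundaryAt-levels v c′ ⟩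
  level-sum 0 ℚ.+ sumℚ (map level-sum (applyUpTo suc (length c′)))
    ≡⟨ cong (level-sum 0 ℚ.+_) (sum-zero level-sum _ upper-sum≡0) ⟩
  level-sum 0 ℚ.+ 0ℚ                                             ≡⟨ ℚ.+-identityʳ _ ⟩
  level-sum 0                                                     ∎
  where
  open ≡-Reasoning
  c′ : List (Elem (suc (suc n″)) (suc t′))
  c′ = standardChainTail n″ (suc t′)
  level-sum : ℕ → ℚ
  level-sum i = sumℚ (map (boundaryTerm v c′ i) (allElems (suc (suc n″)) (suc t′)))
  upper-sum≡0 : ∀ {i} → i ∈ applyUpTo suc (length c′) → level-sum i ≡ 0ℚ
  upper-sum≡0 i∈ with ∈-applyUpTo⁻ suc i∈
  ... | k , k< , refl = sum-zero _ (allElems (suc (suc n″)) (suc t′)) λ {x} _ → term≡0 x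
    where
    term≡0 : ∀ x → boundaryTerm v c′ (suc k) x ≡ 0ℚ
    term≡0 x with chainB (insertAt (suc k) x c′) in chain
    ... | false = refl
    ... | true  = ⊥-elim (insertAbove-notChain n″ k x (subst (k <_) (length-sublevels _ 1 n″) k<) (Equivalence.from T-≡ chain))

trivial-multiplicity0 : ∀ n″ t′ → Multiplicity0 (suc (suc n″)) (suc t′) trivialχ
trivial-multiplicity0 n″ t′ v isotypic@(cycle , _) (c₁ , c₁-top , v₁≢0) =
  sum-0-or-α≢0 (boundaryTerm v c′ 0) α α≢0 0-or-α (allElems-complete (sublevel ρ₀ 0)) c₀-term
    (≡-trans (sym (boundaryAt-standardChainTail n″ t′ v))
             (cycle c′ (chain-tail (sublevel ρ₀ 0) c′ (standardChain-chain (suc n″) t′)) (cong suc c′-length)))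
  where
  ρ₀ : Fin (suc t′) → Fin (suc (suc n″)) → ℕ
  ρ₀ _ a = toℕ a
  c₀ c′ : List (Elem (suc (suc n″)) (suc t′))
  c₀ = standardChain (suc n″) (suc t′)
  c′ = standardChainTail n″ (suc t′)
  c′-length : length c′ ≡ n″
  c′-length = length-sublevels ρ₀ 1 n″
  α : ℚ
  α = v c₀
  constant : ∀ d → TopChain (suc (suc n″)) (suc t′) d → v d ≡ α
  constant d d-top = let g , value = isotypic-value trivialχ d d-top in ≡-trans (value isotypic) (ℚ.*-identityˡ α)
  α≢0 : α ≢ 0ℚ
  α≢0 α≡0 = v₁≢0 (≡-trans (constant c₁ c₁-top) α≡0)
  0-or-α : ∀ x → boundaryTerm v c′ 0 x ≡ 0ℚ ⊎ boundaryTerm v c′ 0 x ≡ α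
  0-or-α x with chainB (x ∷ c′) in chain
  ... | false = inj₁ refl
  ... | true  = inj₂ (≡-trans (ℚ.*-identityˡ _) (constant (x ∷ c′) (Equivalence.from T-≡ chain , cong suc c′-length)))
  c₀-term : boundaryTerm v c′ 0 (sublevel ρ₀ 0) ≡ α
  c₀-term with chainB c₀ | standardChain-chain (suc n″) t′
  ... | true  | _  = ℚ.*-identityˡ α
  ... | false | ()

corollary4p3 : (t n : ℕ) → 1 ≤ t → 1 ≤ n →
    ((n ≡ 1 → Multiplicity1 n t trivialχ) × (n ≢ 1 → Multiplicity0 n t trivialχ))
    × Multiplicity1 n t signχ
corollary4p3 (suc t′) (suc n′) _ _ = (trivial-n≡1 n′ , trivial-n≢1 n′) , sign-multiplicity1 n′ t′
  where
  trivial-n≡1 : ∀ n′ → suc n′ ≡ 1 → Multiplicity1 (suc n′) (suc t′) trivialχ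
  trivial-n≡1 zero refl = trivial-multiplicity1 t′
  trivial-n≢1 : ∀ n′ → suc n′ ≢ 1 → Multiplicity0 (suc n′) (suc t′) trivialχ
  trivial-n≢1 zero     n≢1 = ⊥-elim (n≢1 refl)
  trivial-n≢1 (suc n″) _   = trivial-multiplicity0 n″ t′
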